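{- Let $\lambda$ be a nonzero real number, let $n\ge0$ be an integer, and let $\alpha$ be a complex number with $\alpha+j\neq0$ for $j=0,1,\dots,n$. Then $$ \beta_{n,\lambda}^{(\alpha)}=\alpha\binom{\alpha+n}{n}\sum_{j=0}^{n}(-1)^{j}\binom{n}{j}\frac{1}{(\alpha+j)\binom{n+j}{n}}{n+j \brace j}_{\lambda}. $$
   Context: The degenerate exponential is $e_\lambda(t)=(1+\lambda t)^{1/\lambda}$. The degenerate Bernoulli numbers of order $\alpha$ are defined by the power series expansion $\big(\frac{t}{e_\lambda(t)-1}\big)^{\alpha}=\sum_{n=0}^{\infty}\beta_{n,\lambda}^{(\alpha)}\frac{t^n}{n!}$ (the base has constant term $1$). For a real parameter $\mu$ the degenerate falling factorials are $(x)_{0,\mu}=1$, $(x)_{n,\mu}=x(x-\mu)\cdots(x-(n-1)\mu)$ for $n\ge1$; $(x)_n=(x)_{n,1}$, and $\binom{y}{m}=(y)_m/m!$ for any complex $y$. The degenerate Stirling numbers of the second kind ${n \brace k}_{\mu}$ are defined by $(x)_{n,\mu}=\sum_{k=0}^{n}{n \brace k}_{\mu}(x)_k$. -}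

module Defs where

open import Level using (Level; _⊔_)
open import Data.Nat as ℕ using (ℕ; zero; suc)
open import Data.Nat.Base using (_!)
open import Relation.Nullary using (¬_)
open import Algebra.Bundles using (CommutativeRing)

ringFromℕ : ∀ {c ℓ} (R : CommutativeRing c ℓ) → ℕ → CommutativeRing.Carrier R
ringFromℕ R zero    = CommutativeRing.0# R
ringFromℕ R (suc n) = CommutativeRing._+_ R (CommutativeRing.1# R) (ringFromℕ R n)

record CharZeroField (c ℓ : Level) : Set (Level.suc (c ⊔ ℓ)) where
  field
    commRing : CommutativeRing c ℓ
  open CommutativeRing commRing public
  fromℕ : ℕ → Carrier
  fromℕ = ringFromℕ commRing
  field
    _⁻¹        : Carrier → Carrier
    ⁻¹-cong    : ∀ {x y} → x ≈ y → x ⁻¹ ≈ y ⁻¹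
    ⁻¹-inverse : ∀ x → ¬ (x ≈ 0#) → x * (x ⁻¹) ≈ 1#
    char0      : ∀ n → ¬ (fromℕ (suc n) ≈ 0#)

module Degenerate {c ℓ : Level} (F : CharZeroField c ℓ) where
  open CharZeroField F hiding (zero)

  sumTo : ℕ → (ℕ → Carrier) → Carrier
  sumTo zero    f = f zero
  sumTo (suc n) f = sumTo n f + f (suc n)

  sign : ℕ → Carrier
  sign zero    = 1#
  sign (suc j) = - sign j

  _^_ : Carrier → ℕ → Carrier
  x ^ zero  = 1#
  x ^ suc n = x * (x ^ n)

  fallingDeg : Carrier → ℕ → Carrier → Carrier
  fallingDeg x zero    μ = 1#
  fallingDeg x (suc n) μ = fallingDeg x n μ * (x - fromℕ n * μ)

  falling : Carrier → ℕ → Carrier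
  falling x n = fallingDeg x n 1#

  binom : Carrier → ℕ → Carrier
  binom y m = falling y m * (fromℕ (m !) ⁻¹)

  -- formal power series over the field, as coefficient sequences
  Series : Set c
  Series = ℕ → Carrier

  _·_ : Series → Series → Series
  (f · g) n = sumTo n (λ i → f i * g (n ℕ.∸ i))

  pow : Series → ℕ → Series
  pow u zero    zero    = 1#
  pow u zero    (suc n) = 0#
  pow u (suc k) = u · pow u k

  minusOne : Series → Series
  minusOne f zero    = f zero - 1#
  minusOne f (suc n) = f (suc n)

  -- For a series f with constant term 1 and any a in the field:
  -- f^a := Σ_k binom(a,k) (f - 1)^k   (binomial series; since f - 1 has
  -- zero constant term only k ≤ n contribute to the coefficient of t^n)
  powSeries : Series → Carrier → Series
  powSeries f a n = sumTo n (λ k → binom a k * pow (minusOne f) k n)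

  onePlus : Carrier → Series
  onePlus μ zero          = 1#
  onePlus μ (suc zero)    = μ
  onePlus μ (suc (suc n)) = 0#

  eDeg : Carrier → Series
  eDeg μ = powSeries (onePlus μ) (μ ⁻¹)

  -- (e_μ(t) - 1)/t  (constant term 1)
  eDegShift : Carrier → Series
  eDegShift μ n = eDeg μ (suc n)

  -- multiplicative inverse of a series g with constant term 1:
  -- 1/g = Σ_k (1 - g)^k, i.e. Σ_k (-1)^k (g - 1)^k
  invSeries : Series → Series
  invSeries g n = sumTo n (λ k → sign k * pow (minusOne g) k n)

  bernBase : Carrier → Series
  bernBase μ = invSeries (eDegShift μ)

  -- degenerate Bernoulli numbers of order α:
  -- (t/(e_μ(t)-1))^α = Σ_n β_{n,μ}^{(α)} t^n / n!
  betaDeg : ℕ → Carrier → Carrier → Carrier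
  betaDeg n μ α = fromℕ (n !) * powSeries (bernBase μ) α n

  IsDegStirling2 : Carrier → (ℕ → ℕ → Carrier) → Set (c ⊔ ℓ)
  IsDegStirling2 μ S =
    ∀ (n : ℕ) (x : Carrier) → fallingDeg x n μ ≈ sumTo n (λ k → S n k * falling x k)

-- With g = (e_λ(t) − 1)/t the generating function is (1/g)^α, and as
-- binomial series (1/g)^α = g^(−α) = Σⱼ binom(−α, j) (g − 1)ʲ.  Expanding
-- (g − 1)ʲ binomially and collecting powers of g, the coefficient of gⁱ
-- among the terms j ≤ n has the closed form
-- (−1)ⁱ α binom(α + n, n) C(n, i) / (α + i).  Finally n! [tⁿ] gⁱ is
-- n! [t^(n+i)] (e_λ(t) − 1)ⁱ; since e_λ(t)^r = (1 + λt)^(r/λ) has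
-- coefficients (r)_{N,λ} / N!, binomial inversion of
-- e_λ(t)^r = Σₖ C(r, k) (e_λ(t) − 1)ᵏ against (r)_{N,λ} = Σₖ S(N, k) (r)ₖ
-- gives N! [t^N] (e_λ(t) − 1)ⁱ = i! S(N, i), so n! [tⁿ] gⁱ = S(n + i, i) / C(n + i, n).

module Submission where

open import Defs
open import Level using (Level)
open import Data.Nat using (ℕ; _≤_)
open import Data.Nat.Combinatorics using (_C_)
open import Relation.Nullary using (¬_)

open import Algebra.Bundles using (CommutativeRing; RawRing)
open import Algebra.Solver.Ring.AlmostCommutativeRing
  using (fromCommutativeRing; _-Raw-AlmostCommutative⟶_)
import Algebra.Solver.Ring as RingSolver
import Algebra.Properties.Ring as RingProperties
open import Data.Nat as ℕ using (zero; suc; _<_; z≤n; s≤s; _∸_; _!)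
import Data.Nat.Properties as ℕₚ
open import Data.Nat.Combinatorics
  using (k>n⇒nCk≡0; nCn≡1; nC1≡n; nCk≡nC[n∸k]; nCk+nC[k+1]≡[n+1]C[k+1])
open import Data.Nat.Tactic.RingSolver using (solve-∀)
open import Data.Integer as ℤ using (ℤ; +_; -[1+_]; _⊖_; ∣_∣; _◃_)
import Data.Integer.Properties as ℤ
open import Data.Sign as Sign using (Sign)
open import Data.Maybe using (Maybe; just; nothing)
open import Data.Sum using (inj₁; inj₂)
open import Relation.Nullary using (yes; no)
import Relation.Binary.PropositionalEquality as ≡

-- The ring solver over an arbitrary commutative ring, with integer
-- coefficients interpreted along the canonical map ℤ → R.
module IntegerCoefficients {c ℓ} (R : CommutativeRing c ℓ) where
  open CommutativeRing R
  open import Relation.Binary.Reasoning.Setoid setoid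
  open RingProperties ring using (-‿distribˡ-*; -‿involutive; -0#≈0#; -‿+-comm)

  private
    n̂ : ℕ → Carrier
    n̂ = ringFromℕ R

  ringFromℕ-+ : ∀ m n → n̂ (m ℕ.+ n) ≈ n̂ m + n̂ n
  ringFromℕ-+ zero    n = sym (+-identityˡ _)
  ringFromℕ-+ (suc m) n = trans (+-congˡ (ringFromℕ-+ m n)) (sym (+-assoc _ _ _))

  ringFromℕ-* : ∀ m n → n̂ (m ℕ.* n) ≈ n̂ m * n̂ n
  ringFromℕ-* zero    n = sym (zeroˡ _)
  ringFromℕ-* (suc m) n = begin
    n̂ (n ℕ.+ m ℕ.* n)         ≈⟨ ringFromℕ-+ n (m ℕ.* n) ⟩
    n̂ n + n̂ (m ℕ.* n)         ≈⟨ +-cong (sym (*-identityˡ _)) (ringFromℕ-* m n) ⟩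
    1# * n̂ n + n̂ m * n̂ n      ≈⟨ distribʳ _ _ _ ⟨
    (1# + n̂ m) * n̂ n          ∎

  private
    fromSign : Sign → Carrier
    fromSign Sign.+ = 1#
    fromSign Sign.- = - 1#

    fromSign-* : ∀ s t → fromSign (s Sign.* t) ≈ fromSign s * fromSign t
    fromSign-* Sign.+ t       = sym (*-identityˡ _)
    fromSign-* Sign.- Sign.+  = sym (*-identityʳ _)
    fromSign-* Sign.- Sign.-  = begin
      1#             ≈⟨ -‿involutive _ ⟨
      - - 1#         ≈⟨ -‿cong (sym (*-identityˡ _)) ⟩
      - (1# * - 1#)  ≈⟨ -‿distribˡ-* _ _ ⟩
      - 1# * - 1#    ∎

  fromℤ : ℤ → Carrier
  fromℤ (+ n)    = n̂ n
  fromℤ -[1+ n ] = - n̂ (suc n)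

  private
    fromℤ-◃ : ∀ s n → fromℤ (s ◃ n) ≈ fromSign s * n̂ n
    fromℤ-◃ s      zero    = sym (zeroʳ _)
    fromℤ-◃ Sign.+ (suc n) = sym (*-identityˡ _)
    fromℤ-◃ Sign.- (suc n) = trans (-‿cong (sym (*-identityˡ _))) (-‿distribˡ-* 1# _)

    fromℤ-sign-abs : ∀ i → fromℤ i ≈ fromSign (ℤ.sign i) * n̂ ∣ i ∣
    fromℤ-sign-abs i = trans (reflexive (≡.cong fromℤ (≡.sym (ℤ.◃-inverse i)))) (fromℤ-◃ (ℤ.sign i) ∣ i ∣)

    fromℤ-⊖ : ∀ m n → fromℤ (m ⊖ n) ≈ n̂ m - n̂ n
    fromℤ-⊖ m       zero    = sym (trans (+-congˡ -0#≈0#) (+-identityʳ _))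
    fromℤ-⊖ zero    (suc n) = sym (+-identityˡ _)
    fromℤ-⊖ (suc m) (suc n) = begin
      fromℤ (suc m ⊖ suc n)              ≈⟨ reflexive (≡.cong fromℤ (ℤ.[1+m]⊖[1+n]≡m⊖n m n)) ⟩
      fromℤ (m ⊖ n)                      ≈⟨ fromℤ-⊖ m n ⟩
      n̂ m - n̂ n                          ≈⟨ +-congʳ (+-identityˡ _) ⟨
      (0# + n̂ m) - n̂ n                   ≈⟨ +-congʳ (+-congʳ (-‿inverseʳ 1#)) ⟨
      ((1# - 1#) + n̂ m) - n̂ n            ≈⟨ +-congʳ (+-assoc _ _ _) ⟩
      (1# + (- 1# + n̂ m)) - n̂ n          ≈⟨ +-congʳ (+-congˡ (+-comm _ _)) ⟩
      (1# + (n̂ m - 1#)) - n̂ n            ≈⟨ +-congʳ (+-assoc _ _ _) ⟨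
      ((1# + n̂ m) - 1#) - n̂ n            ≈⟨ +-assoc _ _ _ ⟩
      (1# + n̂ m) + (- 1# - n̂ n)          ≈⟨ +-congˡ (-‿+-comm _ _) ⟩
      (1# + n̂ m) - (1# + n̂ n)            ∎

  fromℤ-+ : ∀ i j → fromℤ (i ℤ.+ j) ≈ fromℤ i + fromℤ j
  fromℤ-+ (+ m)    (+ n)    = ringFromℕ-+ m n
  fromℤ-+ (+ m)    -[1+ n ] = fromℤ-⊖ m (suc n)
  fromℤ-+ -[1+ m ] (+ n)    = trans (fromℤ-⊖ n (suc m)) (+-comm _ _)
  fromℤ-+ -[1+ m ] -[1+ n ] = begin
    - (1# + (1# + n̂ (m ℕ.+ n)))   ≈⟨ -‿cong (+-congˡ (+-congˡ (ringFromℕ-+ m n))) ⟩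
    - (1# + (1# + (n̂ m + n̂ n)))   ≈⟨ -‿cong regroup ⟩
    - ((1# + n̂ m) + (1# + n̂ n))   ≈⟨ -‿+-comm _ _ ⟨
    - (1# + n̂ m) + - (1# + n̂ n)   ∎
    where
    regroup : 1# + (1# + (n̂ m + n̂ n)) ≈ (1# + n̂ m) + (1# + n̂ n)
    regroup = begin
      1# + (1# + (n̂ m + n̂ n))   ≈⟨ +-congˡ (+-assoc _ _ _) ⟨
      1# + ((1# + n̂ m) + n̂ n)   ≈⟨ +-congˡ (+-congʳ (+-comm _ _)) ⟩
      1# + ((n̂ m + 1#) + n̂ n)   ≈⟨ +-congˡ (+-assoc _ _ _) ⟩
      1# + (n̂ m + (1# + n̂ n))   ≈⟨ +-assoc _ _ _ ⟨
      (1# + n̂ m) + (1# + n̂ n)   ∎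

  fromℤ-* : ∀ i j → fromℤ (i ℤ.* j) ≈ fromℤ i * fromℤ j
  fromℤ-* i j = begin
    fromℤ (i ℤ.* j)
      ≈⟨ fromℤ-◃ (ℤ.sign i Sign.* ℤ.sign j) (∣ i ∣ ℕ.* ∣ j ∣) ⟩
    fromSign (ℤ.sign i Sign.* ℤ.sign j) * n̂ (∣ i ∣ ℕ.* ∣ j ∣)
      ≈⟨ *-cong (fromSign-* (ℤ.sign i) (ℤ.sign j)) (ringFromℕ-* ∣ i ∣ ∣ j ∣) ⟩
    (fromSign (ℤ.sign i) * fromSign (ℤ.sign j)) * (n̂ ∣ i ∣ * n̂ ∣ j ∣)
      ≈⟨ interchange ⟩
    (fromSign (ℤ.sign i) * n̂ ∣ i ∣) * (fromSign (ℤ.sign j) * n̂ ∣ j ∣)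
      ≈⟨ *-cong (fromℤ-sign-abs i) (fromℤ-sign-abs j) ⟨
    fromℤ i * fromℤ j ∎
    where
    interchange : ∀ {a b x y} → (a * b) * (x * y) ≈ (a * x) * (b * y)
    interchange = begin
      (_ * _) * (_ * _)   ≈⟨ *-assoc _ _ _ ⟩
      _ * (_ * (_ * _))   ≈⟨ *-congˡ (*-assoc _ _ _) ⟨
      _ * ((_ * _) * _)   ≈⟨ *-congˡ (*-congʳ (*-comm _ _)) ⟩
      _ * ((_ * _) * _)   ≈⟨ *-congˡ (*-assoc _ _ _) ⟩
      _ * (_ * (_ * _))   ≈⟨ *-assoc _ _ _ ⟨
      (_ * _) * (_ * _)   ∎

  fromℤ-neg : ∀ i → fromℤ (ℤ.- i) ≈ - fromℤ i
  fromℤ-neg (+ zero)    = sym -0#≈0#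
  fromℤ-neg (+ suc n)   = refl
  fromℤ-neg -[1+ n ]    = sym (-‿involutive _)

  -- The solver interprets constants by structural recursion, so the
  -- constant +1 must evaluate to 1# on the nose rather than to 1# + 0#.
  private
    n̂′ : ℕ → Carrier
    n̂′ zero          = 0#
    n̂′ (suc zero)    = 1#
    n̂′ (suc (suc n)) = 1# + n̂′ (suc n)

    n̂′≈n̂ : ∀ n → n̂′ n ≈ n̂ n
    n̂′≈n̂ zero          = refl
    n̂′≈n̂ (suc zero)    = sym (+-identityʳ _)
    n̂′≈n̂ (suc (suc n)) = +-congˡ (n̂′≈n̂ (suc n))

    fromℤ′ : ℤ → Carrier
    fromℤ′ (+ n)    = n̂′ n
    fromℤ′ -[1+ n ] = - n̂′ (suc n)

    fromℤ′≈fromℤ : ∀ i → fromℤ′ i ≈ fromℤ i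
    fromℤ′≈fromℤ (+ n)    = n̂′≈n̂ n
    fromℤ′≈fromℤ -[1+ n ] = -‿cong (n̂′≈n̂ (suc n))

    ℤ-rawRing : RawRing _ _
    ℤ-rawRing = record
      { Carrier = ℤ ; _≈_ = ≡._≡_ ; _+_ = ℤ._+_ ; _*_ = ℤ._*_ ; -_ = ℤ.-_ ; 0# = + 0 ; 1# = + 1 }

    homo : ℤ-rawRing -Raw-AlmostCommutative⟶ fromCommutativeRing R
    homo = record
      { ⟦_⟧    = fromℤ′
      ; +-homo = λ i j → trans (fromℤ′≈fromℤ (i ℤ.+ j))
                          (trans (fromℤ-+ i j) (sym (+-cong (fromℤ′≈fromℤ i) (fromℤ′≈fromℤ j))))
      ; *-homo = λ i j → trans (fromℤ′≈fromℤ (i ℤ.* j))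
                          (trans (fromℤ-* i j) (sym (*-cong (fromℤ′≈fromℤ i) (fromℤ′≈fromℤ j))))
      ; -‿homo = λ i → trans (fromℤ′≈fromℤ (ℤ.- i)) (trans (fromℤ-neg i) (sym (-‿cong (fromℤ′≈fromℤ i))))
      ; 0-homo = refl
      ; 1-homo = refl
      }

    weakDecEq : ∀ i j → Maybe (fromℤ′ i ≈ fromℤ′ j)
    weakDecEq i j with i ℤ.≟ j
    ... | yes ≡.refl = just refl
    ... | no _       = nothing

  open RingSolver ℤ-rawRing (fromCommutativeRing R) homo weakDecEq public
    using (solve; _:=_; _:+_; _:*_; _:-_; :-_; con)

module _ where
  open ≡ using (_≡_; refl; cong; cong₂)
  open ≡.≡-Reasoning
  open Data.Nat using (_+_; _*_)

  [1+n]C[1+k]≡nCk+nC[1+k] : ∀ n k → suc n C suc k ≡ (n C k) + (n C suc k)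
  [1+n]C[1+k]≡nCk+nC[1+k] n k = ≡.sym (nCk+nC[k+1]≡[n+1]C[k+1] n k)

  [1+n]C[1+k]*[1+k]≡[1+n]*nCk : ∀ n k → (suc n C suc k) * suc k ≡ suc n * (n C k)
  [1+n]C[1+k]*[1+k]≡[1+n]*nCk zero    zero    = refl
  [1+n]C[1+k]*[1+k]≡[1+n]*nCk zero    (suc k)
    rewrite k>n⇒nCk≡0 {1} {suc (suc k)} (s≤s (s≤s z≤n)) | k>n⇒nCk≡0 {0} {suc k} (s≤s z≤n) = refl
  [1+n]C[1+k]*[1+k]≡[1+n]*nCk (suc n) zero    = begin
    (suc (suc n) C 1) * 1   ≡⟨ cong (_* 1) (nC1≡n (suc (suc n))) ⟩
    suc (suc n) * 1         ∎
  [1+n]C[1+k]*[1+k]≡[1+n]*nCk (suc n) (suc k) = begin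
    (suc (suc n) C suc (suc k)) * suc (suc k)
      ≡⟨ cong (_* suc (suc k)) ([1+n]C[1+k]≡nCk+nC[1+k] (suc n) (suc k)) ⟩
    (a + b) * suc (suc k)
      ≡⟨ split a b k ⟩
    a + (a * suc k + b * suc (suc k))
      ≡⟨ cong₂ (λ x y → a + (x + y)) ([1+n]C[1+k]*[1+k]≡[1+n]*nCk n k) ([1+n]C[1+k]*[1+k]≡[1+n]*nCk n (suc k)) ⟩
    a + (suc n * (n C k) + suc n * (n C suc k))
      ≡⟨ cong (λ x → a + x) (ℕₚ.*-distribˡ-+ (suc n) (n C k) (n C suc k)) ⟨
    a + suc n * ((n C k) + (n C suc k))
      ≡⟨ cong (λ x → a + suc n * x) ([1+n]C[1+k]≡nCk+nC[1+k] n k) ⟨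
    a + suc n * a ∎
    where
    a b : ℕ
    a = suc n C suc k
    b = suc n C suc (suc k)
    split : ∀ a b k → (a + b) * suc (suc k) ≡ a + (a * suc k + b * suc (suc k))
    split = solve-∀

  [1+n]*nCi+i*[1+n]Ci≡[1+n]*[1+n]Ci : ∀ n i → suc n * (n C i) + i * (suc n C i) ≡ suc n * (suc n C i)
  [1+n]*nCi+i*[1+n]Ci≡[1+n]*[1+n]Ci n zero    = ℕₚ.+-identityʳ _
  [1+n]*nCi+i*[1+n]Ci≡[1+n]*[1+n]Ci n (suc i) = begin
    suc n * (n C suc i) + suc i * (suc n C suc i)
      ≡⟨ cong (λ x → suc n * (n C suc i) + x) (ℕₚ.*-comm (suc i) _) ⟩
    suc n * (n C suc i) + (suc n C suc i) * suc i
      ≡⟨ cong (λ x → suc n * (n C suc i) + x) ([1+n]C[1+k]*[1+k]≡[1+n]*nCk n i) ⟩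
    suc n * (n C suc i) + suc n * (n C i)
      ≡⟨ ℕₚ.+-comm (suc n * (n C suc i)) _ ⟩
    suc n * (n C i) + suc n * (n C suc i)
      ≡⟨ ℕₚ.*-distribˡ-+ (suc n) (n C i) (n C suc i) ⟨
    suc n * ((n C i) + (n C suc i))
      ≡⟨ cong (suc n *_) ([1+n]C[1+k]≡nCk+nC[1+k] n i) ⟨
    suc n * (suc n C suc i) ∎

  [n+i]Ci*[i!*n!]≡[n+i]! : ∀ n i → ((n + i) C i) * (i ! * n !) ≡ (n + i) !
  [n+i]Ci*[i!*n!]≡[n+i]! n zero    rewrite ℕₚ.+-identityʳ n = ≡.trans (ℕₚ.*-identityˡ _) (ℕₚ.*-identityˡ _)
  [n+i]Ci*[i!*n!]≡[n+i]! n (suc i) = begin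
    ((n + suc i) C suc i) * (suc i ! * n !)
      ≡⟨ cong (λ m → (m C suc i) * (suc i ! * n !)) (ℕₚ.+-suc n i) ⟩
    (suc (n + i) C suc i) * (suc i * i ! * n !)
      ≡⟨ regroup (suc (n + i) C suc i) (suc i) (i !) (n !) ⟩
    ((suc (n + i) C suc i) * suc i) * (i ! * n !)
      ≡⟨ cong (_* (i ! * n !)) ([1+n]C[1+k]*[1+k]≡[1+n]*nCk (n + i) i) ⟩
    (suc (n + i) * ((n + i) C i)) * (i ! * n !)
      ≡⟨ ℕₚ.*-assoc (suc (n + i)) ((n + i) C i) (i ! * n !) ⟩
    suc (n + i) * (((n + i) C i) * (i ! * n !))
      ≡⟨ cong (suc (n + i) *_) ([n+i]Ci*[i!*n!]≡[n+i]! n i) ⟩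
    suc (n + i) * (n + i) !
      ≡⟨ cong _! (ℕₚ.+-suc n i) ⟨
    (n + suc i) ! ∎
    where
    regroup : ∀ a b c d → a * (b * c * d) ≡ (a * b) * (c * d)
    regroup = solve-∀

  [n+j]Cn≡[n+j]Cj : ∀ n j → (n + j) C n ≡ (n + j) C j
  [n+j]Cn≡[n+j]Cj n j = ≡.trans (nCk≡nC[n∸k] (ℕₚ.m≤m+n n j)) (cong ((n + j) C_) (ℕₚ.m+n∸m≡n n j))

module DegenerateProperties {c ℓ : Level} (F : CharZeroField c ℓ) where
  open CharZeroField F hiding (zero)
  open Degenerate F
  open import Relation.Binary.Reasoning.Setoid setoid
  open RingProperties ring using (-‿distribˡ-*; -‿distribʳ-*; -0#≈0#; -‿+-comm)
  open IntegerCoefficients commRing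
    using (solve; _:=_; _:+_; _:*_; _:-_; :-_; con)
    renaming (ringFromℕ-+ to fromℕ-+; ringFromℕ-* to fromℕ-*)

  fromℕ-1 : fromℕ 1 ≈ 1#
  fromℕ-1 = +-identityʳ 1#

  1≉0 : ¬ (1# ≈ 0#)
  1≉0 1≈0 = char0 0 (trans fromℕ-1 1≈0)

  fromℕ-n!≉0 : ∀ n → ¬ (fromℕ (n !) ≈ 0#)
  fromℕ-n!≉0 n with n ! | n ℕₚ.!≢0
  ... | suc k | _ = char0 k

  x*x⁻¹≈1 : ∀ {x} → ¬ (x ≈ 0#) → x * x ⁻¹ ≈ 1#
  x*x⁻¹≈1 {x} = ⁻¹-inverse x

  x⁻¹*x≈1 : ∀ {x} → ¬ (x ≈ 0#) → x ⁻¹ * x ≈ 1#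
  x⁻¹*x≈1 x≉0 = trans (*-comm _ _) (x*x⁻¹≈1 x≉0)

  a*x≈y⇒x≈a⁻¹*y : ∀ {a x y} → ¬ (a ≈ 0#) → a * x ≈ y → x ≈ a ⁻¹ * y
  a*x≈y⇒x≈a⁻¹*y {a} {x} {y} a≉0 ax≈y = begin
    x                ≈⟨ *-identityˡ x ⟨
    1# * x           ≈⟨ *-congʳ (x⁻¹*x≈1 a≉0) ⟨
    (a ⁻¹ * a) * x   ≈⟨ *-assoc _ _ _ ⟩
    a ⁻¹ * (a * x)   ≈⟨ *-congˡ ax≈y ⟩
    a ⁻¹ * y         ∎

  *-cancelˡ : ∀ {a x y} → ¬ (a ≈ 0#) → a * x ≈ a * y → x ≈ y
  *-cancelˡ a≉0 ax≈ay = trans (a*x≈y⇒x≈a⁻¹*y a≉0 ax≈ay) (sym (a*x≈y⇒x≈a⁻¹*y a≉0 refl))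

  *-cancelʳ-fromℕ-suc : ∀ k {x y} → x * fromℕ (suc k) ≈ y * fromℕ (suc k) → x ≈ y
  *-cancelʳ-fromℕ-suc k eq = *-cancelˡ (char0 k) (trans (*-comm _ _) (trans eq (*-comm _ _)))

  +-cancelˡ : ∀ {x y z} → x + y ≈ x + z → y ≈ z
  +-cancelˡ {x} {y} {z} eq = begin
    y               ≈⟨ solve 2 (λ x y → y := :- x :+ (x :+ y)) refl x y ⟩
    - x + (x + y)   ≈⟨ +-congˡ eq ⟩
    - x + (x + z)   ≈⟨ solve 2 (λ x z → :- x :+ (x :+ z) := z) refl x z ⟩
    z               ∎

  x≈0⇒x*y≈0 : ∀ {x y} → x ≈ 0# → x * y ≈ 0#
  x≈0⇒x*y≈0 {y = y} x≈0 = trans (*-congʳ x≈0) (zeroˡ y)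

  y≈0⇒x*y≈0 : ∀ {x y} → y ≈ 0# → x * y ≈ 0#
  y≈0⇒x*y≈0 {x} y≈0 = trans (*-congˡ y≈0) (zeroʳ x)

  ⁻¹-unique : ∀ {x y} → x * y ≈ 1# → y ≈ x ⁻¹
  ⁻¹-unique {x} {y} xy≈1 = *-cancelˡ x≉0 (trans xy≈1 (sym (x*x⁻¹≈1 x≉0)))
    where
    x≉0 : ¬ (x ≈ 0#)
    x≉0 x≈0 = 1≉0 (trans (sym xy≈1) (x≈0⇒x*y≈0 x≈0))

  1⁻¹≈1 : 1# ⁻¹ ≈ 1#
  1⁻¹≈1 = sym (⁻¹-unique (*-identityˡ 1#))

  ⁻¹-distrib-* : ∀ {x y} → ¬ (x ≈ 0#) → ¬ (y ≈ 0#) → (x * y) ⁻¹ ≈ x ⁻¹ * y ⁻¹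
  ⁻¹-distrib-* {x} {y} x≉0 y≉0 = sym (⁻¹-unique (begin
    (x * y) * (x ⁻¹ * y ⁻¹)
      ≈⟨ solve 4 (λ x y x' y' → (x :* y) :* (x' :* y') := (x :* x') :* (y :* y')) refl x y (x ⁻¹) (y ⁻¹) ⟩
    (x * x ⁻¹) * (y * y ⁻¹)   ≈⟨ *-cong (x*x⁻¹≈1 x≉0) (x*x⁻¹≈1 y≉0) ⟩
    1# * 1#                   ≈⟨ *-identityˡ 1# ⟩
    1#                        ∎))

  [1+k]*[1+k]!⁻¹≈k!⁻¹ : ∀ k → fromℕ (suc k) * fromℕ (suc k !) ⁻¹ ≈ fromℕ (k !) ⁻¹
  [1+k]*[1+k]!⁻¹≈k!⁻¹ k = begin
    fromℕ (suc k) * fromℕ (suc k !) ⁻¹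
      ≈⟨ *-congˡ (⁻¹-cong (fromℕ-* (suc k) (k !))) ⟩
    fromℕ (suc k) * (fromℕ (suc k) * fromℕ (k !)) ⁻¹
      ≈⟨ *-congˡ (⁻¹-distrib-* (char0 k) (fromℕ-n!≉0 k)) ⟩
    fromℕ (suc k) * (fromℕ (suc k) ⁻¹ * fromℕ (k !) ⁻¹)
      ≈⟨ *-assoc _ _ _ ⟨
    (fromℕ (suc k) * fromℕ (suc k) ⁻¹) * fromℕ (k !) ⁻¹
      ≈⟨ *-congʳ (x*x⁻¹≈1 (char0 k)) ⟩
    1# * fromℕ (k !) ⁻¹
      ≈⟨ *-identityˡ _ ⟩
    fromℕ (k !) ⁻¹ ∎

  fromℕ-+-∸ : ∀ {m n} → m ≤ n → fromℕ n ≈ fromℕ m + fromℕ (n ∸ m)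
  fromℕ-+-∸ {m} {n} m≤n = trans (reflexive (≡.cong fromℕ (≡.sym (ℕₚ.m+[n∸m]≡n m≤n)))) (fromℕ-+ m (n ∸ m))

  +-fromℕ-suc : ∀ x n → x + fromℕ (suc n) ≈ (x + fromℕ n) + 1#
  +-fromℕ-suc x n = solve 2 (λ x n → x :+ (con (+ 1) :+ n) := (x :+ n) :+ con (+ 1)) refl x (fromℕ n)

  -- Finite sums

  sumTo-cong : ∀ n {f g : ℕ → Carrier} → (∀ i → i ≤ n → f i ≈ g i) → sumTo n f ≈ sumTo n g
  sumTo-cong zero    f≈g = f≈g 0 z≤n
  sumTo-cong (suc n) f≈g =
    +-cong (sumTo-cong n (λ i i≤n → f≈g i (ℕₚ.m≤n⇒m≤1+n i≤n))) (f≈g (suc n) ℕₚ.≤-refl)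

  sumTo-zero : ∀ n {f : ℕ → Carrier} → (∀ i → i ≤ n → f i ≈ 0#) → sumTo n f ≈ 0#
  sumTo-zero zero    f≈0 = f≈0 0 z≤n
  sumTo-zero (suc n) f≈0 =
    trans (+-cong (sumTo-zero n (λ i i≤n → f≈0 i (ℕₚ.m≤n⇒m≤1+n i≤n))) (f≈0 (suc n) ℕₚ.≤-refl))
          (+-identityʳ 0#)

  sumTo-+ : ∀ n (f g : ℕ → Carrier) → sumTo n (λ i → f i + g i) ≈ sumTo n f + sumTo n g
  sumTo-+ zero    f g = refl
  sumTo-+ (suc n) f g = trans (+-congʳ (sumTo-+ n f g))
    (solve 4 (λ a b x y → (a :+ b) :+ (x :+ y) := (a :+ x) :+ (b :+ y)) refl
      (sumTo n f) (sumTo n g) (f (suc n)) (g (suc n)))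

  sumTo-neg : ∀ n (f : ℕ → Carrier) → - sumTo n f ≈ sumTo n (λ i → - f i)
  sumTo-neg zero    f = refl
  sumTo-neg (suc n) f = trans (sym (-‿+-comm _ _)) (+-congʳ (sumTo-neg n f))

  sumTo-*ˡ : ∀ n (a : Carrier) (f : ℕ → Carrier) → a * sumTo n f ≈ sumTo n (λ i → a * f i)
  sumTo-*ˡ zero    a f = refl
  sumTo-*ˡ (suc n) a f = trans (distribˡ _ _ _) (+-congʳ (sumTo-*ˡ n a f))

  sumTo-*ʳ : ∀ n (a : Carrier) (f : ℕ → Carrier) → sumTo n f * a ≈ sumTo n (λ i → f i * a)
  sumTo-*ʳ n a f = trans (*-comm _ _) (trans (sumTo-*ˡ n a f) (sumTo-cong n (λ i _ → *-comm _ _)))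

  sumTo-suc-head : ∀ n (f : ℕ → Carrier) → sumTo (suc n) f ≈ f 0 + sumTo n (λ i → f (suc i))
  sumTo-suc-head zero    f = refl
  sumTo-suc-head (suc n) f = trans (+-congʳ (sumTo-suc-head n f)) (+-assoc _ _ _)

  sumTo-extend : ∀ {m n} {f : ℕ → Carrier} → m ≤ n → (∀ k → m < k → k ≤ n → f k ≈ 0#) →
                 sumTo n f ≈ sumTo m f
  sumTo-extend {n = zero}  z≤n  _   = refl
  sumTo-extend {m} {suc n} m≤1+n f≈0 with ℕₚ.m≤n⇒m<n∨m≡n m≤1+n
  ... | inj₂ ≡.refl     = refl
  ... | inj₁ (s≤s m≤n) =
    trans (+-cong (sumTo-extend m≤n (λ k m<k k≤n → f≈0 k m<k (ℕₚ.m≤n⇒m≤1+n k≤n)))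
                  (f≈0 (suc n) (s≤s m≤n) ℕₚ.≤-refl))
          (+-identityʳ _)

  sumTo-comm : ∀ n m (h : ℕ → ℕ → Carrier) →
               sumTo n (λ i → sumTo m (λ j → h i j)) ≈ sumTo m (λ j → sumTo n (λ i → h i j))
  sumTo-comm zero    m h = refl
  sumTo-comm (suc n) m h = trans (+-congʳ (sumTo-comm n m h)) (sym (sumTo-+ m _ _))

  sumTo-reverse : ∀ n (f : ℕ → Carrier) → sumTo n f ≈ sumTo n (λ i → f (n ∸ i))
  sumTo-reverse zero    f = refl
  sumTo-reverse (suc n) f = begin
    sumTo n f + f (suc n)                  ≈⟨ +-comm _ _ ⟩
    f (suc n) + sumTo n f                  ≈⟨ +-congˡ (sumTo-reverse n f) ⟩
    f (suc n) + sumTo n (λ i → f (n ∸ i))  ≈⟨ sumTo-suc-head n (λ i → f (suc n ∸ i)) ⟨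
    sumTo (suc n) (λ i → f (suc n ∸ i))    ∎

  sumTo-triangle : ∀ n (h : ℕ → ℕ → Carrier) →
    sumTo n (λ i → sumTo i (λ j → h i j)) ≈ sumTo n (λ j → sumTo (n ∸ j) (λ k → h (j ℕ.+ k) j))
  sumTo-triangle zero    h = refl
  sumTo-triangle (suc n) h = begin
    sumTo n (λ i → sumTo i (λ j → h i j)) + sumTo (suc n) (λ j → h (suc n) j)
      ≈⟨ +-congʳ (sumTo-triangle n h) ⟩
    sumTo n (λ j → column n j) + (sumTo n (λ j → h (suc n) j) + h (suc n) (suc n))
      ≈⟨ +-assoc _ _ _ ⟨
    (sumTo n (λ j → column n j) + sumTo n (λ j → h (suc n) j)) + h (suc n) (suc n)
      ≈⟨ +-cong (sym (sumTo-+ n _ _)) (reflexive (≡.cong (λ z → h z (suc n)) (≡.sym (ℕₚ.+-identityʳ (suc n))))) ⟩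
    sumTo n (λ j → column n j + h (suc n) j) + h (suc n ℕ.+ 0) (suc n)
      ≈⟨ +-cong (sumTo-cong n grow) (reflexive (≡.cong (λ z → sumTo z (λ k → h (suc n ℕ.+ k) (suc n))) (≡.sym (ℕₚ.n∸n≡0 n)))) ⟩
    sumTo n (λ j → column (suc n) j) + column (suc n) (suc n) ∎
    where
    column : ℕ → ℕ → Carrier
    column m j = sumTo (m ∸ j) (λ k → h (j ℕ.+ k) j)

    grow : ∀ j → j ≤ n → column n j + h (suc n) j ≈ column (suc n) j
    grow j j≤n = trans (+-congˡ (reflexive (≡.cong (λ z → h z j) (≡.sym j+[1+n∸j]≡1+n))))
                       (reflexive (≡.cong (λ z → sumTo z (λ k → h (j ℕ.+ k) j)) (≡.sym (ℕₚ.+-∸-assoc 1 j≤n))))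
      where
      j+[1+n∸j]≡1+n : j ℕ.+ suc (n ∸ j) ≡.≡ suc n
      j+[1+n∸j]≡1+n = ≡.trans (ℕₚ.+-suc j (n ∸ j)) (≡.cong suc (ℕₚ.m+[n∸m]≡n j≤n))

  -- Formal power series

  infix 4 _≈ₛ_
  _≈ₛ_ : Series → Series → Set ℓ
  f ≈ₛ g = ∀ n → f n ≈ g n

  ≈ₛ-sym : ∀ {f g} → f ≈ₛ g → g ≈ₛ f
  ≈ₛ-sym f≈g n = sym (f≈g n)

  ≈ₛ-trans : ∀ {f g h} → f ≈ₛ g → g ≈ₛ h → f ≈ₛ h
  ≈ₛ-trans f≈g g≈h n = trans (f≈g n) (g≈h n)

  one : Series
  one zero    = 1#
  one (suc n) = 0#

  infixl 6 _⊕_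
  _⊕_ : Series → Series → Series
  (f ⊕ g) n = f n + g n

  neg : Series → Series
  neg f n = - f n

  -- The index shift c ↦ (0, c₀, c₁, …), i.e. multiplication by t.
  shift : Series → Series
  shift c zero    = 0#
  shift c (suc m) = c m

  pow-zero : ∀ u → pow u 0 ≈ₛ one
  pow-zero u zero    = refl
  pow-zero u (suc n) = refl

  minusOne-split : ∀ f → f ≈ₛ one ⊕ minusOne f
  minusOne-split f zero    = solve 1 (λ a → a := con (+ 1) :+ (a :- con (+ 1))) refl (f 0)
  minusOne-split f (suc n) = sym (+-identityˡ _)

  minusOne-zero : ∀ f → f 0 ≈ 1# → minusOne f 0 ≈ 0#
  minusOne-zero f f0≈1 = trans (+-congʳ f0≈1) (-‿inverseʳ 1#)

  ·-cong : ∀ {f f′ g g′} → f ≈ₛ f′ → g ≈ₛ g′ → f · g ≈ₛ f′ · g′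
  ·-cong f≈f′ g≈g′ n = sumTo-cong n (λ i _ → *-cong (f≈f′ i) (g≈g′ (n ∸ i)))

  ·-congˡ : ∀ f {g g′} → g ≈ₛ g′ → f · g ≈ₛ f · g′
  ·-congˡ f {g} {g′} = ·-cong {f} {f} {g} {g′} (λ _ → refl)

  ·-congʳ : ∀ {f f′} g → f ≈ₛ f′ → f · g ≈ₛ f′ · g
  ·-congʳ {f} {f′} g f≈f′ = ·-cong {f} {f′} {g} {g} f≈f′ (λ _ → refl)

  ·-comm : ∀ f g → f · g ≈ₛ g · f
  ·-comm f g n = begin
    sumTo n (λ i → f i * g (n ∸ i))              ≈⟨ sumTo-reverse n _ ⟩
    sumTo n (λ i → f (n ∸ i) * g (n ∸ (n ∸ i)))  ≈⟨ sumTo-cong n swap ⟩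
    sumTo n (λ i → g i * f (n ∸ i))              ∎
    where
    swap : ∀ i → i ≤ n → f (n ∸ i) * g (n ∸ (n ∸ i)) ≈ g i * f (n ∸ i)
    swap i i≤n = trans (*-comm _ _) (*-congʳ (reflexive (≡.cong g (ℕₚ.m∸[m∸n]≡n i≤n))))

  ·-identityˡ : ∀ f → one · f ≈ₛ f
  ·-identityˡ f zero    = *-identityˡ _
  ·-identityˡ f (suc n) = begin
    sumTo (suc n) (λ i → one i * f (suc n ∸ i))          ≈⟨ sumTo-suc-head n _ ⟩
    1# * f (suc n) + sumTo n (λ i → 0# * f (n ∸ i))      ≈⟨ +-cong (*-identityˡ _) (sumTo-zero n (λ i _ → zeroˡ _)) ⟩
    f (suc n) + 0#                                       ≈⟨ +-identityʳ _ ⟩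
    f (suc n)                                            ∎

  ·-identityʳ : ∀ f → f · one ≈ₛ f
  ·-identityʳ f = ≈ₛ-trans (·-comm f one) (·-identityˡ f)

  ·-distribˡ : ∀ f g h → f · (g ⊕ h) ≈ₛ f · g ⊕ f · h
  ·-distribˡ f g h n = trans (sumTo-cong n (λ i _ → distribˡ _ _ _)) (sumTo-+ n _ _)

  ·-distribʳ : ∀ f g h → (g ⊕ h) · f ≈ₛ g · f ⊕ h · f
  ·-distribʳ f g h n = trans (sumTo-cong n (λ i _ → distribʳ _ _ _)) (sumTo-+ n _ _)

  ·-negʳ : ∀ f g → f · neg g ≈ₛ neg (f · g)
  ·-negʳ f g n = trans (sumTo-cong n (λ i _ → sym (-‿distribʳ-* _ _))) (sym (sumTo-neg n _))

  ·-assoc : ∀ f g h → (f · g) · h ≈ₛ f · (g · h)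
  ·-assoc f g h n = begin
    sumTo n (λ i → sumTo i (λ j → f j * g (i ∸ j)) * h (n ∸ i))
      ≈⟨ sumTo-cong n (λ i _ → sumTo-*ʳ i _ _) ⟩
    sumTo n (λ i → sumTo i (λ j → f j * g (i ∸ j) * h (n ∸ i)))
      ≈⟨ sumTo-triangle n _ ⟩
    sumTo n (λ j → sumTo (n ∸ j) (λ k → f j * g (j ℕ.+ k ∸ j) * h (n ∸ (j ℕ.+ k))))
      ≈⟨ sumTo-cong n (λ j _ → sumTo-cong (n ∸ j) (λ k _ → reindex j k)) ⟩
    sumTo n (λ j → sumTo (n ∸ j) (λ k → f j * (g k * h (n ∸ j ∸ k))))
      ≈⟨ sumTo-cong n (λ j _ → sym (sumTo-*ˡ (n ∸ j) _ _)) ⟩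
    sumTo n (λ j → f j * sumTo (n ∸ j) (λ k → g k * h (n ∸ j ∸ k))) ∎
    where
    reindex : ∀ j k → f j * g (j ℕ.+ k ∸ j) * h (n ∸ (j ℕ.+ k)) ≈ f j * (g k * h (n ∸ j ∸ k))
    reindex j k = trans (*-assoc _ _ _) (*-congˡ (*-cong
      (reflexive (≡.cong g (ℕₚ.m+n∸m≡n j k)))
      (reflexive (≡.cong h (≡.sym (ℕₚ.∸-+-assoc n j k))))))

  ·-sumTo : ∀ (f : Series) j (c : ℕ → Carrier) (G : ℕ → Series) →
            f · (λ n → sumTo j (λ i → c i * G i n)) ≈ₛ (λ n → sumTo j (λ i → c i * (f · G i) n))
  ·-sumTo f j c G n = begin
    sumTo n (λ t → f t * sumTo j (λ i → c i * G i (n ∸ t)))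
      ≈⟨ sumTo-cong n (λ t _ → sumTo-*ˡ j _ _) ⟩
    sumTo n (λ t → sumTo j (λ i → f t * (c i * G i (n ∸ t))))
      ≈⟨ sumTo-comm n j _ ⟩
    sumTo j (λ i → sumTo n (λ t → f t * (c i * G i (n ∸ t))))
      ≈⟨ sumTo-cong j (λ i _ → sumTo-cong n (λ t _ →
           solve 3 (λ a b d → a :* (b :* d) := b :* (a :* d)) refl (f t) (c i) _)) ⟩
    sumTo j (λ i → sumTo n (λ t → c i * (f t * G i (n ∸ t))))
      ≈⟨ sumTo-cong j (λ i _ → sym (sumTo-*ˡ n _ _)) ⟩
    sumTo j (λ i → c i * (f · G i) n) ∎

  pow-below : ∀ {u} → u 0 ≈ 0# → ∀ k n → n < k → pow u k n ≈ 0#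
  pow-below {u} u0≈0 (suc k) n (s≤s n≤k) = sumTo-zero n term≈0
    where
    term≈0 : ∀ i → i ≤ n → u i * pow u k (n ∸ i) ≈ 0#
    term≈0 zero    _ = x≈0⇒x*y≈0 u0≈0
    term≈0 (suc i) (s≤s i≤n-1) =
      y≈0⇒x*y≈0 (pow-below u0≈0 k (n ∸ suc i) n∸[1+i]<k)
      where
      n∸[1+i]<k : n ∸ suc i < k
      n∸[1+i]<k = ℕₚ.<-≤-trans (ℕₚ.∸-monoʳ-< {n} {suc i} {0} (s≤s z≤n) (s≤s i≤n-1)) n≤k

  -- Substitution c ∘ₛ y = Σₘ cₘ yᵐ. When y 0 ≈ 0# only m ≤ n contribute
  -- to the coefficient of tⁿ; powSeries and invSeries are of this form.
  infixr 9 _∘ₛ_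
  _∘ₛ_ : Series → Series → Series
  (c ∘ₛ y) n = sumTo n (λ m → c m * pow y m n)

  ∘ₛ-cong : ∀ {c d} y → c ≈ₛ d → c ∘ₛ y ≈ₛ d ∘ₛ y
  ∘ₛ-cong y c≈d n = sumTo-cong n (λ m _ → *-congʳ (c≈d m))

  ∘ₛ-⊕ : ∀ c d y → (c ⊕ d) ∘ₛ y ≈ₛ c ∘ₛ y ⊕ d ∘ₛ y
  ∘ₛ-⊕ c d y n = trans (sumTo-cong n (λ m _ → distribʳ _ _ _)) (sumTo-+ n _ _)

  ∘ₛ-neg : ∀ c y → neg c ∘ₛ y ≈ₛ neg (c ∘ₛ y)
  ∘ₛ-neg c y n = trans (sumTo-cong n (λ m _ → sym (-‿distribˡ-* _ _))) (sym (sumTo-neg n _))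

  module _ (y : Series) (y0≈0 : y 0 ≈ 0#) where

    ∘ₛ-extend : ∀ c {n N} → n ≤ N → (c ∘ₛ y) n ≈ sumTo N (λ m → c m * pow y m n)
    ∘ₛ-extend c n≤N =
      sym (sumTo-extend n≤N (λ k n<k _ → y≈0⇒x*y≈0 (pow-below y0≈0 k _ n<k)))

    one-∘ₛ : one ∘ₛ y ≈ₛ one
    one-∘ₛ zero    = *-identityˡ 1#
    one-∘ₛ (suc n) = begin
      sumTo (suc n) (λ m → one m * pow y m (suc n))                ≈⟨ sumTo-suc-head n _ ⟩
      1# * 0# + sumTo n (λ m → 0# * pow y (suc m) (suc n))         ≈⟨ +-cong (zeroʳ _) (sumTo-zero n (λ i _ → zeroˡ _)) ⟩
      0# + 0#                                                      ≈⟨ +-identityʳ _ ⟩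
      0#                                                           ∎

    ·-∘ₛ : ∀ c → y · (c ∘ₛ y) ≈ₛ shift c ∘ₛ y
    ·-∘ₛ c n = begin
      sumTo n (λ i → y i * (c ∘ₛ y) (n ∸ i))
        ≈⟨ sumTo-cong n (λ i _ → *-congˡ (∘ₛ-extend c (ℕₚ.m∸n≤m n i))) ⟩
      sumTo n (λ i → y i * sumTo n (λ m → c m * pow y m (n ∸ i)))
        ≈⟨ sumTo-cong n (λ i _ → sumTo-*ˡ n _ _) ⟩
      sumTo n (λ i → sumTo n (λ m → y i * (c m * pow y m (n ∸ i))))
        ≈⟨ sumTo-comm n n _ ⟩
      sumTo n (λ m → sumTo n (λ i → y i * (c m * pow y m (n ∸ i))))
        ≈⟨ sumTo-cong n (λ m _ → sumTo-cong n (λ i _ →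
             solve 3 (λ a b d → a :* (b :* d) := b :* (a :* d)) refl (y i) (c m) _)) ⟩
      sumTo n (λ m → sumTo n (λ i → c m * (y i * pow y m (n ∸ i))))
        ≈⟨ sumTo-cong n (λ m _ → sym (sumTo-*ˡ n _ _)) ⟩
      sumTo n (λ m → c m * pow y (suc m) n)
        ≈⟨ +-identityˡ _ ⟨
      0# + sumTo n (λ m → c m * pow y (suc m) n)
        ≈⟨ +-congʳ (zeroˡ _) ⟨
      shift c 0 * pow y 0 n + sumTo n (λ m → shift c (suc m) * pow y (suc m) n)
        ≈⟨ sumTo-suc-head n _ ⟨
      sumTo (suc n) (λ m → shift c m * pow y m n)
        ≈⟨ ∘ₛ-extend (shift c) (ℕₚ.n≤1+n n) ⟨
      (shift c ∘ₛ y) n ∎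

  -- Generalised binomial coefficients

  falling-cong : ∀ {x y} k → x ≈ y → falling x k ≈ falling y k
  falling-cong zero    x≈y = refl
  falling-cong (suc k) x≈y = *-cong (falling-cong k x≈y) (+-congʳ x≈y)

  binom-cong : ∀ {x y} k → x ≈ y → binom x k ≈ binom y k
  binom-cong k x≈y = *-congʳ (falling-cong k x≈y)

  binom-zero : ∀ y → binom y 0 ≈ 1#
  binom-zero y = trans (*-identityˡ _) (trans (⁻¹-cong fromℕ-1) 1⁻¹≈1)

  binom-suc : ∀ y k → binom y (suc k) * fromℕ (suc k) ≈ binom y k * (y - fromℕ k * 1#)
  binom-suc y k = begin
    falling y k * (y - fromℕ k * 1#) * fromℕ (suc k !) ⁻¹ * fromℕ (suc k)
      ≈⟨ solve 4 (λ a b c d → a :* b :* c :* d := a :* (c :* d) :* b) refl (falling y k) (y - fromℕ k * 1#) _ _ ⟩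
    falling y k * (fromℕ (suc k !) ⁻¹ * fromℕ (suc k)) * (y - fromℕ k * 1#)
      ≈⟨ *-congʳ (*-congˡ (trans (*-comm _ _) ([1+k]*[1+k]!⁻¹≈k!⁻¹ k))) ⟩
    falling y k * fromℕ (k !) ⁻¹ * (y - fromℕ k * 1#) ∎

  falling-suc-+1 : ∀ y k → falling (y + 1#) (suc k) ≈ (y + 1#) * falling y k
  falling-suc-+1 y zero = solve 1 (λ y →
    con (+ 1) :* ((y :+ con (+ 1)) :- con (+ 0) :* con (+ 1)) := (y :+ con (+ 1)) :* con (+ 1)) refl y
  falling-suc-+1 y (suc k) = begin
    falling (y + 1#) (suc k) * ((y + 1#) - fromℕ (suc k) * 1#)
      ≈⟨ *-congʳ (falling-suc-+1 y k) ⟩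
    ((y + 1#) * falling y k) * ((y + 1#) - (1# + fromℕ k) * 1#)
      ≈⟨ solve 3 (λ y f n → ((y :+ con (+ 1)) :* f) :* ((y :+ con (+ 1)) :- (con (+ 1) :+ n) :* con (+ 1))
                            := (y :+ con (+ 1)) :* (f :* (y :- n :* con (+ 1)))) refl y (falling y k) (fromℕ k) ⟩
    (y + 1#) * (falling y k * (y - fromℕ k * 1#)) ∎

  binom-suc-+1 : ∀ y k → binom (y + 1#) (suc k) * fromℕ (suc k) ≈ binom y k * (y + 1#)
  binom-suc-+1 y k = begin
    falling (y + 1#) (suc k) * fromℕ (suc k !) ⁻¹ * fromℕ (suc k)
      ≈⟨ *-congʳ (*-congʳ (falling-suc-+1 y k)) ⟩
    (y + 1#) * falling y k * fromℕ (suc k !) ⁻¹ * fromℕ (suc k)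
      ≈⟨ solve 4 (λ a b c d → a :* b :* c :* d := b :* (c :* d) :* a) refl (y + 1#) (falling y k) _ _ ⟩
    falling y k * (fromℕ (suc k !) ⁻¹ * fromℕ (suc k)) * (y + 1#)
      ≈⟨ *-congʳ (*-congˡ (trans (*-comm _ _) ([1+k]*[1+k]!⁻¹≈k!⁻¹ k))) ⟩
    falling y k * fromℕ (k !) ⁻¹ * (y + 1#) ∎

  binom-pascal : ∀ y k → binom (y + 1#) (suc k) ≈ binom y (suc k) + binom y k
  binom-pascal y k = *-cancelʳ-fromℕ-suc k (begin
    binom (y + 1#) (suc k) * fromℕ (suc k)
      ≈⟨ binom-suc-+1 y k ⟩
    binom y k * (y + 1#)
      ≈⟨ solve 3 (λ b y n → b :* (y :+ con (+ 1)) := b :* (y :- n :* con (+ 1)) :+ b :* (con (+ 1) :+ n))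
                 refl (binom y k) y (fromℕ k) ⟩
    binom y k * (y - fromℕ k * 1#) + binom y k * fromℕ (suc k)
      ≈⟨ +-congʳ (binom-suc y k) ⟨
    binom y (suc k) * fromℕ (suc k) + binom y k * fromℕ (suc k)
      ≈⟨ distribʳ _ _ _ ⟨
    (binom y (suc k) + binom y k) * fromℕ (suc k) ∎)

  -- Powers of the reciprocal series

  -- invPowCoeff k m is the coefficient of uᵐ in ((1 + u)⁻¹ − 1)ᵏ; the
  -- recursion is (1 + u) · invPowCoeff (k + 1) = − u · invPowCoeff k.
  invPowCoeff : ℕ → ℕ → Carrier
  invPowCoeff zero    m       = one m
  invPowCoeff (suc k) zero    = 0#
  invPowCoeff (suc k) (suc m) = - invPowCoeff k m - invPowCoeff (suc k) m

  invPowCoeff-below : ∀ k m → m < k → invPowCoeff k m ≈ 0#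
  invPowCoeff-below (suc k) zero    _         = refl
  invPowCoeff-below (suc k) (suc m) (s≤s m<k) = begin
    - invPowCoeff k m - invPowCoeff (suc k) m
      ≈⟨ +-cong (-‿cong (invPowCoeff-below k m m<k))
                (-‿cong (invPowCoeff-below (suc k) m (ℕₚ.m<n⇒m<1+n m<k))) ⟩
    - 0# - 0#  ≈⟨ solve 0 (:- con (+ 0) :- con (+ 0) := con (+ 0)) refl ⟩
    0#         ∎

  invPowCoeff-recurrence : ∀ k → invPowCoeff (suc k) ⊕ shift (invPowCoeff (suc k)) ≈ₛ neg (shift (invPowCoeff k))
  invPowCoeff-recurrence k zero    = trans (+-identityʳ 0#) (sym -0#≈0#)
  invPowCoeff-recurrence k (suc m) =
    solve 2 (λ a b → (:- a :- b) :+ b := :- a) refl (invPowCoeff k m) (invPowCoeff (suc k) m)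

  sign-shift : sign ⊕ shift sign ≈ₛ one
  sign-shift zero    = +-identityʳ 1#
  sign-shift (suc n) = -‿inverseˡ (sign n)

  module Reciprocal (g : Series) (g0≈1 : g 0 ≈ 1#) where
    private
      u v : Series
      u = minusOne g
      v = minusOne (invSeries g)

      u0≈0 : u 0 ≈ 0#
      u0≈0 = minusOne-zero g g0≈1

    invSeries-inverseˡ : invSeries g · g ≈ₛ one
    invSeries-inverseˡ n = begin
      (invSeries g · g) n                    ≈⟨ ·-congˡ (invSeries g) (minusOne-split g) n ⟩
      (invSeries g · (one ⊕ u)) n            ≈⟨ ·-distribˡ (invSeries g) one u n ⟩
      (invSeries g · one) n + (invSeries g · u) n
        ≈⟨ +-cong (·-identityʳ (invSeries g) n) (·-comm (invSeries g) u n) ⟩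
      (sign ∘ₛ u) n + (u · (sign ∘ₛ u)) n    ≈⟨ +-congˡ (·-∘ₛ u u0≈0 sign n) ⟩
      (sign ∘ₛ u) n + (shift sign ∘ₛ u) n    ≈⟨ ∘ₛ-⊕ sign (shift sign) u n ⟨
      ((sign ⊕ shift sign) ∘ₛ u) n           ≈⟨ ∘ₛ-cong u sign-shift n ⟩
      (one ∘ₛ u) n                           ≈⟨ one-∘ₛ u u0≈0 n ⟩
      one n                                  ∎

    ·-cancelʳ : ∀ {f h} → f · g ≈ₛ h · g → f ≈ₛ h
    ·-cancelʳ {f} {h} fg≈hg n = begin
      f n                    ≈⟨ ·-identityʳ f n ⟨
      (f · one) n            ≈⟨ ·-congˡ f g·B≈1 n ⟨
      (f · (g · B)) n        ≈⟨ ·-assoc f g B n ⟨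
      ((f · g) · B) n        ≈⟨ ·-congʳ B fg≈hg n ⟩
      ((h · g) · B) n        ≈⟨ ·-assoc h g B n ⟩
      (h · (g · B)) n        ≈⟨ ·-congˡ h g·B≈1 n ⟩
      (h · one) n            ≈⟨ ·-identityʳ h n ⟩
      h n                    ∎
      where
      B : Series
      B = invSeries g
      g·B≈1 : g · B ≈ₛ one
      g·B≈1 = ≈ₛ-trans (·-comm g B) invSeries-inverseˡ

    private
      v·g≈-u : v · g ≈ₛ neg u
      v·g≈-u n = begin
        (v · g) n                              ≈⟨ solve 2 (λ a b → a := (b :+ a) :- b) refl _ (g n) ⟩
        (g n + (v · g) n) - g n                ≈⟨ +-cong (+-congʳ (sym (·-identityˡ g n))) (-‿cong (minusOne-split g n)) ⟩
        ((one · g) n + (v · g) n) - (one n + u n) ≈⟨ +-congʳ (sym (·-distribʳ g one v n)) ⟩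
        ((one ⊕ v) · g) n - (one n + u n)       ≈⟨ +-congʳ (·-congʳ g (≈ₛ-sym (minusOne-split (invSeries g))) n) ⟩
        (invSeries g · g) n - (one n + u n)     ≈⟨ +-congʳ (invSeries-inverseˡ n) ⟩
        one n - (one n + u n)                   ≈⟨ solve 2 (λ a b → a :- (a :+ b) := :- b) refl (one n) (u n) ⟩
        - u n                                   ∎

    pow-minusOne-invSeries : ∀ k → pow v k ≈ₛ invPowCoeff k ∘ₛ u
    pow-minusOne-invSeries zero    = ≈ₛ-trans (pow-zero v) (≈ₛ-sym (one-∘ₛ u u0≈0))
    pow-minusOne-invSeries (suc k) = ·-cancelʳ (λ n → begin
      ((v · pow v k) · g) n              ≈⟨ ·-congʳ g (·-comm v (pow v k)) n ⟩
      ((pow v k · v) · g) n              ≈⟨ ·-assoc (pow v k) v g n ⟩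
      (pow v k · (v · g)) n              ≈⟨ ·-congˡ (pow v k) v·g≈-u n ⟩
      (pow v k · neg u) n                ≈⟨ ·-negʳ (pow v k) u n ⟩
      - (pow v k · u) n                  ≈⟨ -‿cong (·-comm (pow v k) u n) ⟩
      - (u · pow v k) n                  ≈⟨ -‿cong (·-congˡ u (pow-minusOne-invSeries k) n) ⟩
      - (u · (W k ∘ₛ u)) n               ≈⟨ -‿cong (·-∘ₛ u u0≈0 (W k) n) ⟩
      - (shift (W k) ∘ₛ u) n             ≈⟨ ∘ₛ-neg (shift (W k)) u n ⟨
      (neg (shift (W k)) ∘ₛ u) n         ≈⟨ ∘ₛ-cong u (invPowCoeff-recurrence k) n ⟨
      ((W (suc k) ⊕ shift (W (suc k))) ∘ₛ u) n
        ≈⟨ ∘ₛ-⊕ (W (suc k)) (shift (W (suc k))) u n ⟩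
      Y n + (shift (W (suc k)) ∘ₛ u) n   ≈⟨ +-cong (sym (·-identityʳ Y n)) (sym (·-∘ₛ u u0≈0 (W (suc k)) n)) ⟩
      (Y · one) n + (u · Y) n            ≈⟨ +-congˡ (·-comm u Y n) ⟩
      (Y · one) n + (Y · u) n            ≈⟨ ·-distribˡ Y one u n ⟨
      (Y · (one ⊕ u)) n                  ≈⟨ ·-congˡ Y (minusOne-split g) n ⟨
      (Y · g) n                          ∎)
      where
      W : ℕ → ℕ → Carrier
      W = invPowCoeff
      Y : Series
      Y = W (suc k) ∘ₛ u

  binom-neg-suc : ∀ α m → binom (- α) (suc m) ≈ sign (suc m) * binom (α + fromℕ m) (suc m)
  binom-neg-suc α zero = *-cancelʳ-fromℕ-suc 0 (begin
    binom (- α) 1 * fromℕ 1                       ≈⟨ binom-suc (- α) 0 ⟩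
    binom (- α) 0 * (- α - 0# * 1#)               ≈⟨ *-congʳ (binom-zero (- α)) ⟩
    1# * (- α - 0# * 1#)
      ≈⟨ solve 1 (λ a → con (+ 1) :* (:- a :- con (+ 0) :* con (+ 1))
                        := :- con (+ 1) :* (con (+ 1) :* ((a :+ con (+ 0)) :- con (+ 0) :* con (+ 1)))) refl α ⟩
    - 1# * (1# * ((α + 0#) - 0# * 1#))            ≈⟨ *-congˡ (*-congʳ (binom-zero (α + 0#))) ⟨
    - 1# * (binom (α + 0#) 0 * ((α + 0#) - 0# * 1#)) ≈⟨ *-congˡ (binom-suc (α + 0#) 0) ⟨
    - 1# * (binom (α + 0#) 1 * fromℕ 1)           ≈⟨ *-assoc _ _ _ ⟨
    - 1# * binom (α + 0#) 1 * fromℕ 1             ∎)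
  binom-neg-suc α (suc m) = *-cancelʳ-fromℕ-suc (suc m) (begin
    binom (- α) (suc (suc m)) * fromℕ (suc (suc m))
      ≈⟨ binom-suc (- α) (suc m) ⟩
    binom (- α) (suc m) * (- α - fromℕ (suc m) * 1#)
      ≈⟨ *-congʳ (binom-neg-suc α m) ⟩
    (sign (suc m) * b) * (- α - (1# + fromℕ m) * 1#)
      ≈⟨ solve 4 (λ s b a n → (s :* b) :* (:- a :- (con (+ 1) :+ n) :* con (+ 1))
                              := :- s :* (b :* ((a :+ n) :+ con (+ 1)))) refl (sign (suc m)) b α (fromℕ m) ⟩
    - sign (suc m) * (b * ((α + fromℕ m) + 1#))
      ≈⟨ *-congˡ (binom-suc-+1 (α + fromℕ m) (suc m)) ⟨
    - sign (suc m) * (binom ((α + fromℕ m) + 1#) (suc (suc m)) * fromℕ (suc (suc m)))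
      ≈⟨ *-congˡ (*-congʳ (binom-cong (suc (suc m)) (+-fromℕ-suc α m))) ⟨
    - sign (suc m) * (binom (α + fromℕ (suc m)) (suc (suc m)) * fromℕ (suc (suc m)))
      ≈⟨ *-assoc _ _ _ ⟨
    - sign (suc m) * binom (α + fromℕ (suc m)) (suc (suc m)) * fromℕ (suc (suc m)) ∎)
    where
    b : Carrier
    b = binom (α + fromℕ m) (suc m)

  -- The coefficient of uᵐ in ((1 + u)⁻¹)^α, generalised over a shift s of
  -- both the exponent and the summation index to make it inductive in m.
  module _ (α : Carrier) where
    private
      W : ℕ → ℕ → Carrier
      W = invPowCoeff

    binomInvSum : ℕ → ℕ → Carrier
    binomInvSum s m = sumTo m (λ k → binom (α + fromℕ s) (k ℕ.+ s) * W k m)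

    binomInvSum-suc : ∀ s m →
      binomInvSum s (suc m) ≈ - binomInvSum (suc s) m + binom (α + fromℕ s) s * W 0 m
    binomInvSum-suc s m = begin
      T s (suc m)
        ≈⟨ sumTo-suc-head m _ ⟩
      binom y s * 0# + sumTo m (λ k → b′ k * (- W k m - W (suc k) m))
        ≈⟨ +-cong (zeroʳ _) (sumTo-cong m (λ k _ →
             trans (distribˡ _ _ _) (+-cong (sym (-‿distribʳ-* _ _)) (sym (-‿distribʳ-* _ _))))) ⟩
      0# + sumTo m (λ k → - (b′ k * W k m) + - (t (suc k)))
        ≈⟨ +-congˡ (trans (sumTo-+ m _ _) (+-cong (sym (sumTo-neg m _)) (sym (sumTo-neg m _)))) ⟩
      0# + (- A + - H)
        ≈⟨ +-congˡ (+-cong (-‿cong A≈) (-‿cong H≈)) ⟩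
      0# + (- (T (suc s) m - T s m) + - (T s m - t 0))
        ≈⟨ solve 3 (λ a b c → con (+ 0) :+ (:- (a :- b) :+ :- (b :- c)) := :- a :+ c) refl (T (suc s) m) (T s m) (t 0) ⟩
      - T (suc s) m + t 0 ∎
      where
      T : ℕ → ℕ → Carrier
      T = binomInvSum
      y : Carrier
      y = α + fromℕ s
      b′ : ℕ → Carrier
      b′ k = binom y (suc (k ℕ.+ s))
      t : ℕ → Carrier
      t k = binom y (k ℕ.+ s) * W k m
      A H : Carrier
      A = sumTo m (λ k → b′ k * W k m)
      H = sumTo m (λ k → t (suc k))

      H≈ : H ≈ T s m - t 0
      H≈ = begin
        H                         ≈⟨ solve 2 (λ a b → a := (b :+ a) :- b) refl H (t 0) ⟩
        (t 0 + H) - t 0           ≈⟨ +-congʳ (sumTo-suc-head m t) ⟨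
        (T s m + t (suc m)) - t 0 ≈⟨ +-congʳ (+-congˡ (y≈0⇒x*y≈0 (invPowCoeff-below (suc m) m (ℕₚ.n<1+n m)))) ⟩
        (T s m + 0#) - t 0        ≈⟨ +-congʳ (+-identityʳ _) ⟩
        T s m - t 0               ∎

      A≈ : A ≈ T (suc s) m - T s m
      A≈ = begin
        A
          ≈⟨ solve 2 (λ a b → a := (a :+ b) :- b) refl A (T s m) ⟩
        (A + T s m) - T s m
          ≈⟨ +-congʳ (sym (sumTo-+ m _ _)) ⟩
        sumTo m (λ k → b′ k * W k m + t k) - T s m
          ≈⟨ +-congʳ (sumTo-cong m (λ k _ → sym (distribʳ _ _ _))) ⟩
        sumTo m (λ k → (b′ k + binom y (k ℕ.+ s)) * W k m) - T s m
          ≈⟨ +-congʳ (sumTo-cong m (λ k _ → *-congʳ (sym (binom-pascal y (k ℕ.+ s))))) ⟩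
        sumTo m (λ k → binom (y + 1#) (suc (k ℕ.+ s)) * W k m) - T s m
          ≈⟨ +-congʳ (sumTo-cong m (λ k _ → *-congʳ (trans
               (binom-cong (suc (k ℕ.+ s)) (sym (+-fromℕ-suc α s)))
               (reflexive (≡.cong (binom (α + fromℕ (suc s))) (≡.sym (ℕₚ.+-suc k s))))))) ⟩
        T (suc s) m - T s m ∎

    binomInvSum-closed : ∀ m s → binomInvSum s (suc m) ≈ sign (suc m) * binom (α + fromℕ (s ℕ.+ m)) (suc (s ℕ.+ m))
    binomInvSum-closed zero s = begin
      binomInvSum s 1
        ≈⟨ binomInvSum-suc s 0 ⟩
      - (binom (α + fromℕ (suc s)) (suc s) * 1#) + binom y s * 1#
        ≈⟨ +-congʳ (-‿cong (*-congʳ (trans (binom-cong (suc s) (+-fromℕ-suc α s)) (binom-pascal y s)))) ⟩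
      - ((binom y (suc s) + binom y s) * 1#) + binom y s * 1#
        ≈⟨ solve 2 (λ a b → :- ((a :+ b) :* con (+ 1)) :+ b :* con (+ 1) := (:- con (+ 1)) :* a) refl (binom y (suc s)) (binom y s) ⟩
      - 1# * binom y (suc s)
        ≈⟨ *-congˡ (reflexive (≡.cong (λ z → binom (α + fromℕ z) (suc z)) (≡.sym (ℕₚ.+-identityʳ s)))) ⟩
      - 1# * binom (α + fromℕ (s ℕ.+ 0)) (suc (s ℕ.+ 0)) ∎
      where
      y : Carrier
      y = α + fromℕ s
    binomInvSum-closed (suc m) s = begin
      binomInvSum s (suc (suc m))
        ≈⟨ binomInvSum-suc s (suc m) ⟩
      - binomInvSum (suc s) (suc m) + binom (α + fromℕ s) s * 0#
        ≈⟨ +-cong (-‿cong (binomInvSum-closed m (suc s))) (zeroʳ _) ⟩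
      - (sign (suc m) * binom (α + fromℕ (suc s ℕ.+ m)) (suc (suc s ℕ.+ m))) + 0#
        ≈⟨ trans (+-identityʳ _) (-‿distribˡ-* _ _) ⟩
      - sign (suc m) * binom (α + fromℕ (suc s ℕ.+ m)) (suc (suc s ℕ.+ m))
        ≈⟨ *-congˡ (reflexive (≡.cong (λ z → binom (α + fromℕ z) (suc z)) (≡.sym (ℕₚ.+-suc s m)))) ⟩
      - sign (suc m) * binom (α + fromℕ (s ℕ.+ suc m)) (suc (s ℕ.+ suc m)) ∎

    binom-invPowCoeff-sum : ∀ m → sumTo m (λ k → binom α k * W k m) ≈ binom (- α) m
    binom-invPowCoeff-sum zero    = trans (*-congʳ (binom-zero α)) (trans (*-identityˡ 1#) (sym (binom-zero (- α))))
    binom-invPowCoeff-sum (suc m) = begin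
      sumTo (suc m) (λ k → binom α k * W k (suc m))
        ≈⟨ sumTo-cong (suc m) (λ k _ → *-congʳ (trans (binom-cong k (sym (+-identityʳ α)))
             (reflexive (≡.cong (binom (α + 0#)) (≡.sym (ℕₚ.+-identityʳ k)))))) ⟩
      binomInvSum 0 (suc m)                         ≈⟨ binomInvSum-closed m 0 ⟩
      sign (suc m) * binom (α + fromℕ m) (suc m)    ≈⟨ binom-neg-suc α m ⟨
      binom (- α) (suc m)                           ∎

  powSeries-invSeries : ∀ g → g 0 ≈ 1# → ∀ α → powSeries (invSeries g) α ≈ₛ powSeries g (- α)
  powSeries-invSeries g g0≈1 α n = begin
    sumTo n (λ k → binom α k * pow v k n)
      ≈⟨ sumTo-cong n (λ k _ → *-congˡ (pow-minusOne-invSeries k n)) ⟩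
    sumTo n (λ k → binom α k * sumTo n (λ m → W k m * pow u m n))
      ≈⟨ sumTo-cong n (λ k _ → sumTo-*ˡ n _ _) ⟩
    sumTo n (λ k → sumTo n (λ m → binom α k * (W k m * pow u m n)))
      ≈⟨ sumTo-comm n n _ ⟩
    sumTo n (λ m → sumTo n (λ k → binom α k * (W k m * pow u m n)))
      ≈⟨ sumTo-cong n (λ m _ → trans (sumTo-cong n (λ k _ → sym (*-assoc _ _ _))) (sym (sumTo-*ʳ n _ _))) ⟩
    sumTo n (λ m → sumTo n (λ k → binom α k * W k m) * pow u m n)
      ≈⟨ sumTo-cong n (λ m m≤n → *-congʳ (trans
           (sumTo-extend m≤n (λ k m<k _ → y≈0⇒x*y≈0 (invPowCoeff-below k m m<k)))
           (binom-invPowCoeff-sum α m))) ⟩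
    sumTo n (λ m → binom (- α) m * pow u m n) ∎
    where
    open Reciprocal g g0≈1
    W : ℕ → ℕ → Carrier
    W = invPowCoeff
    u v : Series
    u = minusOne g
    v = minusOne (invSeries g)

  -- Expansion in powers of a series

  binomℕ : ℕ → ℕ → Carrier
  binomℕ n k = fromℕ (n C k)

  binomℕ-above : ∀ {n k} → n < k → binomℕ n k ≈ 0#
  binomℕ-above n<k = reflexive (≡.cong fromℕ (k>n⇒nCk≡0 n<k))

  binomℕ-diag : ∀ n → binomℕ n n ≈ 1#
  binomℕ-diag n = trans (reflexive (≡.cong fromℕ (nCn≡1 n))) fromℕ-1

  binomℕ-pascal : ∀ n k → binomℕ (suc n) (suc k) ≈ binomℕ n k + binomℕ n (suc k)
  binomℕ-pascal n k = trans (reflexive (≡.cong fromℕ ([1+n]C[1+k]≡nCk+nC[1+k] n k))) (fromℕ-+ (n C k) (n C suc k))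

  binomℕ-absorb : ∀ n k → binomℕ (suc n) (suc k) * fromℕ (suc k) ≈ fromℕ (suc n) * binomℕ n k
  binomℕ-absorb n k = begin
    binomℕ (suc n) (suc k) * fromℕ (suc k)  ≈⟨ fromℕ-* (suc n C suc k) (suc k) ⟨
    fromℕ ((suc n C suc k) ℕ.* suc k)       ≈⟨ reflexive (≡.cong fromℕ ([1+n]C[1+k]*[1+k]≡[1+n]*nCk n k)) ⟩
    fromℕ (suc n ℕ.* (n C k))               ≈⟨ fromℕ-* (suc n) (n C k) ⟩
    fromℕ (suc n) * binomℕ n k              ∎

  -- The signed binomial coefficient (−1)^{j+i} C(j,i): the coefficient of
  -- gⁱ in (g − 1)ʲ.
  signedBinom : ℕ → ℕ → Carrier
  signedBinom j i = sign j * sign i * binomℕ j i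

  signedBinom-above : ∀ {j i} → j < i → signedBinom j i ≈ 0#
  signedBinom-above j<i = y≈0⇒x*y≈0 (binomℕ-above j<i)

  signedBinom-suc-zero : ∀ j → signedBinom (suc j) 0 ≈ - signedBinom j 0
  signedBinom-suc-zero j =
    solve 2 (λ s c → :- s :* con (+ 1) :* c := :- (s :* con (+ 1) :* c)) refl (sign j) (binomℕ (suc j) 0)

  signedBinom-pascal : ∀ j i → signedBinom (suc j) (suc i) ≈ signedBinom j i - signedBinom j (suc i)
  signedBinom-pascal j i = begin
    (- sign j) * (- sign i) * binomℕ (suc j) (suc i)     ≈⟨ *-congˡ (binomℕ-pascal j i) ⟩
    (- sign j) * (- sign i) * (binomℕ j i + binomℕ j (suc i))
      ≈⟨ solve 4 (λ s t a b → (:- s) :* (:- t) :* (a :+ b) := s :* t :* a :- s :* (:- t) :* b) refl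
                 (sign j) (sign i) (binomℕ j i) (binomℕ j (suc i)) ⟩
    signedBinom j i - signedBinom j (suc i) ∎

  pow-minusOne : ∀ g j → pow (minusOne g) j ≈ₛ (λ n → sumTo j (λ i → signedBinom j i * pow g i n))
  pow-minusOne g zero    n = begin
    pow (minusOne g) 0 n             ≈⟨ pow-zero (minusOne g) n ⟩
    one n                            ≈⟨ pow-zero g n ⟨
    pow g 0 n                        ≈⟨ *-identityˡ _ ⟨
    1# * pow g 0 n                   ≈⟨ *-congʳ (trans (*-cong (*-identityˡ 1#) fromℕ-1) (*-identityˡ 1#)) ⟨
    signedBinom 0 0 * pow g 0 n      ∎
  pow-minusOne g (suc j) n = begin
    (u · pow u j) n
      ≈⟨ ·-congˡ u (pow-minusOne g j) n ⟩
    (u · G j) n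
      ≈⟨ ·-congʳ (G j) u≈g-1 n ⟩
    ((g ⊕ neg one) · G j) n
      ≈⟨ ·-distribʳ (G j) g (neg one) n ⟩
    (g · G j) n + (neg one · G j) n
      ≈⟨ +-cong (·-sumTo g j (signedBinom j) (pow g) n)
                (trans (·-comm (neg one) (G j) n) (trans (·-negʳ (G j) one n) (-‿cong (·-identityʳ (G j) n)))) ⟩
    sumTo j (λ i → signedBinom j i * pow g (suc i) n) - G j n
      ≈⟨ +-congˡ (-‿cong (sumTo-extend (ℕₚ.n≤1+n j) (λ k j<k _ → x≈0⇒x*y≈0 (signedBinom-above j<k)))) ⟨
    sumTo j (λ i → signedBinom j i * pow g (suc i) n) - sumTo (suc j) (λ i → signedBinom j i * pow g i n)
      ≈⟨ +-congˡ (-‿cong (sumTo-suc-head j _)) ⟩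
    P - (signedBinom j 0 * pow g 0 n + Q)
      ≈⟨ solve 3 (λ a b c → a :- (b :+ c) := :- b :+ (a :- c)) refl P (signedBinom j 0 * pow g 0 n) Q ⟩
    - (signedBinom j 0 * pow g 0 n) + (P - Q)
      ≈⟨ +-cong (trans (-‿distribˡ-* _ _) (*-congʳ (sym (signedBinom-suc-zero j))))
                (trans (+-congˡ (sumTo-neg j _)) (trans (sym (sumTo-+ j _ _)) (sumTo-cong j (λ i _ →
                  trans (+-congˡ (-‿distribˡ-* _ _)) (trans (sym (distribʳ _ _ _))
                        (*-congʳ (sym (signedBinom-pascal j i))))))))  ⟩
    signedBinom (suc j) 0 * pow g 0 n + sumTo j (λ i → signedBinom (suc j) (suc i) * pow g (suc i) n)
      ≈⟨ sumTo-suc-head j _ ⟨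
    G (suc j) n ∎
    where
    u : Series
    u = minusOne g
    G : ℕ → Series
    G j n = sumTo j (λ i → signedBinom j i * pow g i n)
    P Q : Carrier
    P = sumTo j (λ i → signedBinom j i * pow g (suc i) n)
    Q = sumTo j (λ i → signedBinom j (suc i) * pow g (suc i) n)

    u≈g-1 : u ≈ₛ g ⊕ neg one
    u≈g-1 zero    = refl
    u≈g-1 (suc n) = sym (trans (+-congˡ -0#≈0#) (+-identityʳ _))

  -- The coefficient of gⁱ in the truncation Σ_{j≤n} binom(a,j) (g − 1)ʲ.
  powersCoeff : Carrier → ℕ → ℕ → Carrier
  powersCoeff a n i = sumTo n (λ j → binom a j * signedBinom j i)

  powSeries-powers : ∀ g a n → powSeries g a n ≈ sumTo n (λ i → powersCoeff a n i * pow g i n)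
  powSeries-powers g a n = begin
    sumTo n (λ j → binom a j * pow (minusOne g) j n)
      ≈⟨ sumTo-cong n (λ j _ → *-congˡ (pow-minusOne g j n)) ⟩
    sumTo n (λ j → binom a j * sumTo j (λ i → signedBinom j i * pow g i n))
      ≈⟨ sumTo-cong n (λ j j≤n → *-congˡ (sym (sumTo-extend j≤n (λ i j<i _ → x≈0⇒x*y≈0 (signedBinom-above j<i))))) ⟩
    sumTo n (λ j → binom a j * sumTo n (λ i → signedBinom j i * pow g i n))
      ≈⟨ sumTo-cong n (λ j _ → sumTo-*ˡ n _ _) ⟩
    sumTo n (λ j → sumTo n (λ i → binom a j * (signedBinom j i * pow g i n)))
      ≈⟨ sumTo-comm n n _ ⟩
    sumTo n (λ i → sumTo n (λ j → binom a j * (signedBinom j i * pow g i n)))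
      ≈⟨ sumTo-cong n (λ i _ → trans (sumTo-cong n (λ j _ → sym (*-assoc _ _ _))) (sym (sumTo-*ʳ n _ _))) ⟩
    sumTo n (λ i → powersCoeff a n i * pow g i n) ∎

  α*binom[α+n,n]≈±binom[-α,n]*[α+n] : ∀ α n →
    α * binom (α + fromℕ n) n ≈ sign n * binom (- α) n * (α + fromℕ n)
  α*binom[α+n,n]≈±binom[-α,n]*[α+n] α zero = begin
    α * binom (α + 0#) 0    ≈⟨ *-congˡ (binom-zero (α + 0#)) ⟩
    α * 1#                  ≈⟨ solve 1 (λ a → a :* con (+ 1) := con (+ 1) :* con (+ 1) :* (a :+ con (+ 0))) refl α ⟩
    1# * 1# * (α + 0#)      ≈⟨ *-congʳ (*-congˡ (binom-zero (- α))) ⟨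
    1# * binom (- α) 0 * (α + 0#) ∎
  α*binom[α+n,n]≈±binom[-α,n]*[α+n] α (suc n) = *-cancelʳ-fromℕ-suc n (begin
    α * binom (α + fromℕ (suc n)) (suc n) * fromℕ (suc n)
      ≈⟨ *-assoc _ _ _ ⟩
    α * (binom (α + fromℕ (suc n)) (suc n) * fromℕ (suc n))
      ≈⟨ *-congˡ (*-congʳ (binom-cong (suc n) (+-fromℕ-suc α n))) ⟩
    α * (binom ((α + fromℕ n) + 1#) (suc n) * fromℕ (suc n))
      ≈⟨ *-congˡ (binom-suc-+1 (α + fromℕ n) n) ⟩
    α * (binom (α + fromℕ n) n * ((α + fromℕ n) + 1#))
      ≈⟨ *-assoc _ _ _ ⟨
    α * binom (α + fromℕ n) n * ((α + fromℕ n) + 1#)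
      ≈⟨ *-congʳ (α*binom[α+n,n]≈±binom[-α,n]*[α+n] α n) ⟩
    sign n * b n * (α + fromℕ n) * ((α + fromℕ n) + 1#)
      ≈⟨ solve 4 (λ s c a m → s :* c :* (a :+ m) :* ((a :+ m) :+ con (+ 1))
                              := :- s :* (c :* (:- a :- m :* con (+ 1))) :* (a :+ (con (+ 1) :+ m)))
                 refl (sign n) (b n) α (fromℕ n) ⟩
    (- sign n) * (b n * (- α - fromℕ n * 1#)) * (α + fromℕ (suc n))
      ≈⟨ *-congʳ (*-congˡ (binom-suc (- α) n)) ⟨
    (- sign n) * (b (suc n) * fromℕ (suc n)) * (α + fromℕ (suc n))
      ≈⟨ solve 4 (λ s c f a → s :* (c :* f) :* a := s :* c :* a :* f) refl
                 (- sign n) (b (suc n)) (fromℕ (suc n)) (α + fromℕ (suc n)) ⟩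
    (- sign n) * b (suc n) * (α + fromℕ (suc n)) * fromℕ (suc n) ∎)
    where
    b : ℕ → Carrier
    b = binom (- α)

  [1+n]*C[n,i]≈[1+n]*C[1+n,i]-i*C[1+n,i] : ∀ n i →
    fromℕ (suc n) * binomℕ n i ≈ fromℕ (suc n) * binomℕ (suc n) i - fromℕ i * binomℕ (suc n) i
  [1+n]*C[n,i]≈[1+n]*C[1+n,i]-i*C[1+n,i] n i = begin
    fromℕ (suc n) * binomℕ n i
      ≈⟨ solve 2 (λ a b → a := (a :+ b) :- b) refl _ (fromℕ i * binomℕ (suc n) i) ⟩
    (fromℕ (suc n) * binomℕ n i + fromℕ i * binomℕ (suc n) i) - fromℕ i * binomℕ (suc n) i
      ≈⟨ +-congʳ (+-cong (fromℕ-* (suc n) (n C i)) (fromℕ-* i (suc n C i))) ⟨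
    (fromℕ (suc n ℕ.* (n C i)) + fromℕ (i ℕ.* (suc n C i))) - fromℕ i * binomℕ (suc n) i
      ≈⟨ +-congʳ (fromℕ-+ (suc n ℕ.* (n C i)) (i ℕ.* (suc n C i))) ⟨
    fromℕ (suc n ℕ.* (n C i) ℕ.+ i ℕ.* (suc n C i)) - fromℕ i * binomℕ (suc n) i
      ≈⟨ +-congʳ (reflexive (≡.cong fromℕ ([1+n]*nCi+i*[1+n]Ci≡[1+n]*[1+n]Ci n i))) ⟩
    fromℕ (suc n ℕ.* (suc n C i)) - fromℕ i * binomℕ (suc n) i
      ≈⟨ +-congʳ (fromℕ-* (suc n) (suc n C i)) ⟩
    fromℕ (suc n) * binomℕ (suc n) i - fromℕ i * binomℕ (suc n) i ∎

  alternatingSum : Carrier → ℕ → ℕ → Carrier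
  alternatingSum α n i = sumTo n (λ j → (binom (- α) j * sign j) * binomℕ j i)

  alternatingSum-closed : ∀ α n i → (α + fromℕ i) * alternatingSum α n i ≈ α * binom (α + fromℕ n) n * binomℕ n i
  alternatingSum-closed α zero zero = begin
    (α + 0#) * ((b 0 * 1#) * binomℕ 0 0)  ≈⟨ *-congˡ (*-cong (*-congʳ (binom-zero (- α))) fromℕ-1) ⟩
    (α + 0#) * ((1# * 1#) * 1#)
      ≈⟨ solve 1 (λ a → (a :+ con (+ 0)) :* ((con (+ 1) :* con (+ 1)) :* con (+ 1)) := a :* con (+ 1) :* con (+ 1)) refl α ⟩
    α * 1# * 1#                           ≈⟨ *-cong (*-congˡ (binom-zero (α + 0#))) fromℕ-1 ⟨
    α * binom (α + 0#) 0 * binomℕ 0 0     ∎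
    where
    b : ℕ → Carrier
    b = binom (- α)
  alternatingSum-closed α zero (suc i) =
    trans (y≈0⇒x*y≈0 (y≈0⇒x*y≈0 C[0,1+i]≈0)) (sym (y≈0⇒x*y≈0 C[0,1+i]≈0))
    where
    C[0,1+i]≈0 : binomℕ 0 (suc i) ≈ 0#
    C[0,1+i]≈0 = binomℕ-above {0} {suc i} (s≤s z≤n)
  alternatingSum-closed α (suc n) i = *-cancelʳ-fromℕ-suc n (begin
    (a * (alternatingSum α n i + (b (suc n) * sign (suc n)) * c₁)) * N
      ≈⟨ *-congʳ (distribˡ _ _ _) ⟩
    (a * alternatingSum α n i + a * ((b (suc n) * sign (suc n)) * c₁)) * N
      ≈⟨ *-congʳ (+-congʳ (alternatingSum-closed α n i)) ⟩
    (α * B n * c₀ + a * ((b (suc n) * sign (suc n)) * c₁)) * N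
      ≈⟨ solve 8 (λ α bn c₀ a bs s c₁ m →
           (α :* bn :* c₀ :+ a :* ((bs :* (:- s)) :* c₁)) :* (con (+ 1) :+ m)
           := α :* bn :* ((con (+ 1) :+ m) :* c₀) :- a :* s :* c₁ :* (bs :* (con (+ 1) :+ m)))
           refl α (B n) c₀ a (b (suc n)) (sign n) c₁ (fromℕ n) ⟩
    α * B n * (N * c₀) - a * sign n * c₁ * (b (suc n) * N)
      ≈⟨ +-cong (*-congʳ (α*binom[α+n,n]≈±binom[-α,n]*[α+n] α n)) (-‿cong (*-congˡ (binom-suc (- α) n))) ⟩
    sign n * b n * (α + fromℕ n) * (N * c₀) - a * sign n * c₁ * (b n * (- α - fromℕ n * 1#))
      ≈⟨ +-congʳ (*-congˡ ([1+n]*C[n,i]≈[1+n]*C[1+n,i]-i*C[1+n,i] n i)) ⟩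
    sign n * b n * (α + fromℕ n) * (N * c₁ - fromℕ i * c₁) - a * sign n * c₁ * (b n * (- α - fromℕ n * 1#))
      ≈⟨ solve 6 (λ s bb α m c i →
           s :* bb :* (α :+ m) :* ((con (+ 1) :+ m) :* c :- i :* c) :- (α :+ i) :* s :* c :* (bb :* (:- α :- m :* con (+ 1)))
           := s :* bb :* (α :+ m) :* ((α :+ m) :+ con (+ 1)) :* c)
           refl (sign n) (b n) α (fromℕ n) c₁ (fromℕ i) ⟩
    sign n * b n * (α + fromℕ n) * ((α + fromℕ n) + 1#) * c₁
      ≈⟨ *-congʳ (*-congʳ (α*binom[α+n,n]≈±binom[-α,n]*[α+n] α n)) ⟨
    α * B n * ((α + fromℕ n) + 1#) * c₁
      ≈⟨ *-congʳ (trans (*-assoc _ _ _) (*-congˡ (sym B[1+n]*N))) ⟩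
    α * (B (suc n) * N) * c₁
      ≈⟨ solve 4 (λ a x y z → a :* (x :* y) :* z := a :* x :* z :* y) refl α (B (suc n)) N c₁ ⟩
    α * B (suc n) * c₁ * N ∎)
    where
    a N c₀ c₁ : Carrier
    a = α + fromℕ i
    N = fromℕ (suc n)
    c₀ = binomℕ n i
    c₁ = binomℕ (suc n) i
    b : ℕ → Carrier
    b = binom (- α)
    B : ℕ → Carrier
    B m = binom (α + fromℕ m) m
    B[1+n]*N : B (suc n) * N ≈ B n * ((α + fromℕ n) + 1#)
    B[1+n]*N = trans (*-congʳ (binom-cong (suc n) (+-fromℕ-suc α n))) (binom-suc-+1 (α + fromℕ n) n)

  powersCoeff-neg : ∀ α n i →
    (α + fromℕ i) * powersCoeff (- α) n i ≈ sign i * (α * binom (α + fromℕ n) n * binomℕ n i)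
  powersCoeff-neg α n i = begin
    (α + fromℕ i) * powersCoeff (- α) n i
      ≈⟨ *-congˡ (sumTo-cong n (λ j _ → solve 4 (λ b s t c → b :* (s :* t :* c) := t :* ((b :* s) :* c)) refl
                                           (binom (- α) j) (sign j) (sign i) (binomℕ j i))) ⟩
    (α + fromℕ i) * sumTo n (λ j → sign i * ((binom (- α) j * sign j) * binomℕ j i))
      ≈⟨ *-congˡ (sumTo-*ˡ n _ _) ⟨
    (α + fromℕ i) * (sign i * alternatingSum α n i)
      ≈⟨ solve 3 (λ a s k → a :* (s :* k) := s :* (a :* k)) refl (α + fromℕ i) (sign i) (alternatingSum α n i) ⟩
    sign i * ((α + fromℕ i) * alternatingSum α n i)
      ≈⟨ *-congˡ (alternatingSum-closed α n i) ⟩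
    sign i * (α * binom (α + fromℕ n) n * binomℕ n i) ∎

  fallingDeg-zero : ∀ μ k → fallingDeg 0# (suc k) μ ≈ 0#
  fallingDeg-zero μ zero    = solve 1 (λ m → con (+ 1) :* (con (+ 0) :- con (+ 0) :* m) := con (+ 0)) refl μ
  fallingDeg-zero μ (suc k) = x≈0⇒x*y≈0 (fallingDeg-zero μ k)

  falling-fromℕ : ∀ r k → falling (fromℕ r) k ≈ fromℕ (k !) * binomℕ r k
  falling-fromℕ r       zero    = sym (trans (*-cong fromℕ-1 fromℕ-1) (*-identityˡ 1#))
  falling-fromℕ zero    (suc k) = trans (fallingDeg-zero 1# k) (sym (y≈0⇒x*y≈0 (binomℕ-above {0} {suc k} (s≤s z≤n))))
  falling-fromℕ (suc r) (suc k) = begin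
    falling (1# + fromℕ r) (suc k)               ≈⟨ falling-cong (suc k) (+-comm _ _) ⟩
    falling (fromℕ r + 1#) (suc k)               ≈⟨ falling-suc-+1 (fromℕ r) k ⟩
    (fromℕ r + 1#) * falling (fromℕ r) k         ≈⟨ *-congˡ (falling-fromℕ r k) ⟩
    (fromℕ r + 1#) * (fromℕ (k !) * binomℕ r k)
      ≈⟨ solve 3 (λ r f c → (r :+ con (+ 1)) :* (f :* c) := f :* ((con (+ 1) :+ r) :* c)) refl (fromℕ r) (fromℕ (k !)) (binomℕ r k) ⟩
    fromℕ (k !) * (fromℕ (suc r) * binomℕ r k)   ≈⟨ *-congˡ (binomℕ-absorb r k) ⟨
    fromℕ (k !) * (binomℕ (suc r) (suc k) * fromℕ (suc k))
      ≈⟨ solve 3 (λ f c s → f :* (c :* s) := s :* f :* c) refl (fromℕ (k !)) (binomℕ (suc r) (suc k)) (fromℕ (suc k)) ⟩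
    fromℕ (suc k) * fromℕ (k !) * binomℕ (suc r) (suc k) ≈⟨ *-congʳ (fromℕ-* (suc k) (k !)) ⟨
    fromℕ (suc k !) * binomℕ (suc r) (suc k)     ∎

  -- The system r ↦ Σ_{k≤r} C(r,k) a_k is unitriangular, hence injective.
  binomialTransform-injective : ∀ N (a b : ℕ → Carrier) →
    (∀ r → r ≤ N → sumTo r (λ k → binomℕ r k * a k) ≈ sumTo r (λ k → binomℕ r k * b k)) →
    ∀ k → k ≤ N → a k ≈ b k
  binomialTransform-injective N a b eq k k≤N = upTo k k≤N k ℕₚ.≤-refl
    where
    diag≉0 : ∀ r → ¬ (binomℕ r r ≈ 0#)
    diag≉0 r diag≈0 = 1≉0 (trans (sym (binomℕ-diag r)) diag≈0)

    upTo : ∀ k → k ≤ N → ∀ j → j ≤ k → a j ≈ b j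
    upTo zero    _   zero z≤n = *-cancelˡ (diag≉0 0) (eq 0 z≤n)
    upTo (suc k) k<N j j≤1+k with ℕₚ.m≤n⇒m<n∨m≡n j≤1+k
    ... | inj₁ (s≤s j≤k) = upTo k (ℕₚ.<⇒≤ k<N) j j≤k
    ... | inj₂ ≡.refl    = *-cancelˡ (diag≉0 (suc k)) (+-cancelˡ (trans
          (+-congʳ (sumTo-cong k (λ i i≤k → *-congˡ (sym (upTo k (ℕₚ.<⇒≤ k<N) i i≤k)))))
          (eq (suc k) k<N)))

  pow-binomial : ∀ f → f 0 ≈ 1# → ∀ r → pow f r ≈ₛ binomℕ r ∘ₛ minusOne f
  pow-binomial f f0≈1 zero    n = begin
    pow f 0 n                          ≈⟨ pow-zero f n ⟩
    one n                              ≈⟨ one-∘ₛ u u0≈0 n ⟨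
    (one ∘ₛ u) n                       ≈⟨ ∘ₛ-cong u binomℕ-0≈one n ⟨
    (binomℕ 0 ∘ₛ u) n                  ∎
    where
    u : Series
    u = minusOne f
    u0≈0 : u 0 ≈ 0#
    u0≈0 = minusOne-zero f f0≈1
    binomℕ-0≈one : binomℕ 0 ≈ₛ one
    binomℕ-0≈one zero    = fromℕ-1
    binomℕ-0≈one (suc k) = binomℕ-above {0} {suc k} (s≤s z≤n)
  pow-binomial f f0≈1 (suc r) n = begin
    (f · pow f r) n                             ≈⟨ ·-congˡ f (pow-binomial f f0≈1 r) n ⟩
    (f · (binomℕ r ∘ₛ u)) n                     ≈⟨ ·-congʳ (binomℕ r ∘ₛ u) (minusOne-split f) n ⟩
    ((one ⊕ u) · (binomℕ r ∘ₛ u)) n             ≈⟨ ·-distribʳ (binomℕ r ∘ₛ u) one u n ⟩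
    (one · (binomℕ r ∘ₛ u)) n + (u · (binomℕ r ∘ₛ u)) n
      ≈⟨ +-cong (·-identityˡ (binomℕ r ∘ₛ u) n) (·-∘ₛ u u0≈0 (binomℕ r) n) ⟩
    (binomℕ r ∘ₛ u) n + (shift (binomℕ r) ∘ₛ u) n ≈⟨ ∘ₛ-⊕ (binomℕ r) (shift (binomℕ r)) u n ⟨
    ((binomℕ r ⊕ shift (binomℕ r)) ∘ₛ u) n      ≈⟨ ∘ₛ-cong u pascal n ⟩
    (binomℕ (suc r) ∘ₛ u) n                     ∎
    where
    u : Series
    u = minusOne f
    u0≈0 : u 0 ≈ 0#
    u0≈0 = minusOne-zero f f0≈1
    pascal : binomℕ r ⊕ shift (binomℕ r) ≈ₛ binomℕ (suc r)
    pascal zero    = +-identityʳ _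
    pascal (suc k) = trans (+-comm _ _) (sym (binomℕ-pascal r k))

  -- The degenerate exponential

  module DegenerateExponential (lam : Carrier) (lam≉0 : ¬ (lam ≈ 0#)) where

    degBinom : ℕ → Carrier → Carrier
    degBinom N x = fallingDeg x N lam * fromℕ (N !) ⁻¹

    degBinom-zero : ∀ x → degBinom 0 x ≈ 1#
    degBinom-zero x = trans (*-identityˡ _) (trans (⁻¹-cong fromℕ-1) 1⁻¹≈1)

    degBinom-suc : ∀ N x → degBinom (suc N) x * fromℕ (suc N) ≈ degBinom N x * (x - fromℕ N * lam)
    degBinom-suc N x = begin
      (fallingDeg x N lam * (x - fromℕ N * lam)) * fromℕ (suc N !) ⁻¹ * fromℕ (suc N)
        ≈⟨ solve 4 (λ a b c d → a :* b :* c :* d := a :* (c :* d) :* b) refl (fallingDeg x N lam) (x - fromℕ N * lam) _ _ ⟩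
      fallingDeg x N lam * (fromℕ (suc N !) ⁻¹ * fromℕ (suc N)) * (x - fromℕ N * lam)
        ≈⟨ *-congʳ (*-congˡ (trans (*-comm _ _) ([1+k]*[1+k]!⁻¹≈k!⁻¹ N))) ⟩
      fallingDeg x N lam * fromℕ (N !) ⁻¹ * (x - fromℕ N * lam) ∎

    degConvolution : ℕ → Carrier → Carrier → Carrier
    degConvolution N x y = sumTo N (λ i → degBinom i x * degBinom (N ∸ i) y)

    degConvolution-suc : ∀ N x y →
      degConvolution N x y * ((x + y) - fromℕ N * lam) ≈ degConvolution (suc N) x y * fromℕ (suc N)
    degConvolution-suc N x y = begin
      sumTo N (λ i → p i x * p (N ∸ i) y) * ((x + y) - fromℕ N * lam)
        ≈⟨ sumTo-*ʳ N _ _ ⟩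
      sumTo N (λ i → p i x * p (N ∸ i) y * ((x + y) - fromℕ N * lam))
        ≈⟨ sumTo-cong N split ⟩
      sumTo N (λ i → A i + B i)
        ≈⟨ sumTo-+ N A B ⟩
      sumTo N A + sumTo N B
        ≈⟨ +-cong ΣA ΣB ⟩
      sumTo (suc N) (λ i → t i * fromℕ i) + sumTo (suc N) (λ i → t i * fromℕ (suc N ∸ i))
        ≈⟨ sumTo-+ (suc N) _ _ ⟨
      sumTo (suc N) (λ i → t i * fromℕ i + t i * fromℕ (suc N ∸ i))
        ≈⟨ sumTo-cong (suc N) (λ i i≤ → trans (sym (distribˡ _ _ _)) (*-congˡ (sym (fromℕ-+-∸ i≤)))) ⟩
      sumTo (suc N) (λ i → t i * fromℕ (suc N))
        ≈⟨ sumTo-*ʳ (suc N) _ _ ⟨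
      sumTo (suc N) (λ i → p i x * p (suc N ∸ i) y) * fromℕ (suc N) ∎
      where
      p : ℕ → Carrier → Carrier
      p = degBinom
      t : ℕ → Carrier
      t i = p i x * p (suc N ∸ i) y
      A B : ℕ → Carrier
      A i = p (suc i) x * fromℕ (suc i) * p (N ∸ i) y
      B i = p i x * (p (suc (N ∸ i)) y * fromℕ (suc (N ∸ i)))

      split : ∀ i → i ≤ N → p i x * p (N ∸ i) y * ((x + y) - fromℕ N * lam) ≈ A i + B i
      split i i≤N = begin
        p i x * p (N ∸ i) y * ((x + y) - fromℕ N * lam)
          ≈⟨ *-congˡ (+-congˡ (-‿cong (*-congʳ (fromℕ-+-∸ i≤N)))) ⟩
        p i x * p (N ∸ i) y * ((x + y) - (fromℕ i + fromℕ (N ∸ i)) * lam)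
          ≈⟨ solve 7 (λ P Q x y a c l → P :* Q :* ((x :+ y) :- (a :+ c) :* l)
                                        := P :* (x :- a :* l) :* Q :+ P :* (Q :* (y :- c :* l)))
                     refl (p i x) (p (N ∸ i) y) x y (fromℕ i) (fromℕ (N ∸ i)) lam ⟩
        p i x * (x - fromℕ i * lam) * p (N ∸ i) y + p i x * (p (N ∸ i) y * (y - fromℕ (N ∸ i) * lam))
          ≈⟨ +-cong (*-congʳ (sym (degBinom-suc i x))) (*-congˡ (sym (degBinom-suc (N ∸ i) y))) ⟩
        A i + B i ∎

      ΣA : sumTo N A ≈ sumTo (suc N) (λ i → t i * fromℕ i)
      ΣA = begin
        sumTo N A
          ≈⟨ +-identityˡ _ ⟨
        0# + sumTo N A
          ≈⟨ +-cong (sym (zeroʳ _)) (sumTo-cong N (λ i _ →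
               solve 3 (λ a f b → a :* f :* b := a :* b :* f) refl (p (suc i) x) (fromℕ (suc i)) (p (N ∸ i) y))) ⟩
        t 0 * fromℕ 0 + sumTo N (λ i → t (suc i) * fromℕ (suc i))
          ≈⟨ sumTo-suc-head N _ ⟨
        sumTo (suc N) (λ i → t i * fromℕ i) ∎

      ΣB : sumTo N B ≈ sumTo (suc N) (λ i → t i * fromℕ (suc N ∸ i))
      ΣB = begin
        sumTo N B
          ≈⟨ +-identityʳ _ ⟨
        sumTo N B + 0#
          ≈⟨ +-cong (sumTo-cong N Bi≈) (sym (y≈0⇒x*y≈0 (reflexive (≡.cong fromℕ (ℕₚ.n∸n≡0 N))))) ⟩
        sumTo N (λ i → t i * fromℕ (suc N ∸ i)) + t (suc N) * fromℕ (suc N ∸ suc N) ∎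
        where
        Bi≈ : ∀ i → i ≤ N → B i ≈ t i * fromℕ (suc N ∸ i)
        Bi≈ i i≤N = trans (sym (*-assoc _ _ _))
          (reflexive (≡.cong (λ z → p i x * p z y * fromℕ z) (≡.sym (ℕₚ.+-∸-assoc 1 i≤N))))

    degBinom-vandermonde : ∀ N x y → degBinom N (x + y) ≈ degConvolution N x y
    degBinom-vandermonde zero x y =
      trans (degBinom-zero (x + y)) (sym (trans (*-cong (degBinom-zero x) (degBinom-zero y)) (*-identityˡ 1#)))
    degBinom-vandermonde (suc N) x y = *-cancelʳ-fromℕ-suc N (begin
      degBinom (suc N) (x + y) * fromℕ (suc N)              ≈⟨ degBinom-suc N (x + y) ⟩
      degBinom N (x + y) * ((x + y) - fromℕ N * lam)        ≈⟨ *-congʳ (degBinom-vandermonde N x y) ⟩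
      degConvolution N x y * ((x + y) - fromℕ N * lam)      ≈⟨ degConvolution-suc N x y ⟩
      degConvolution (suc N) x y * fromℕ (suc N)            ∎)

    private
      λt : Series
      λt = minusOne (onePlus lam)

      λt·f : ∀ f m → (λt · f) (suc m) ≈ lam * f m
      λt·f f m = begin
        sumTo (suc m) (λ i → λt i * f (suc m ∸ i))
          ≈⟨ sumTo-suc-head m _ ⟩
        λt 0 * f (suc m) + sumTo m (λ i → onePlus lam (suc i) * f (m ∸ i))
          ≈⟨ +-cong (x≈0⇒x*y≈0 (-‿inverseʳ 1#)) (tail m) ⟩
        0# + lam * f m
          ≈⟨ +-identityˡ _ ⟩
        lam * f m ∎
        where
        tail : ∀ m → sumTo m (λ i → onePlus lam (suc i) * f (m ∸ i)) ≈ lam * f m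
        tail zero    = refl
        tail (suc m) = trans (sumTo-suc-head m _) (trans (+-congˡ (sumTo-zero m (λ i _ → zeroˡ _))) (+-identityʳ _))

      pow-λt-above : ∀ k m → k < m → pow λt k m ≈ 0#
      pow-λt-above zero    (suc m) _         = refl
      pow-λt-above (suc k) (suc m) (s≤s k<m) = trans (λt·f (pow λt k) m) (y≈0⇒x*y≈0 (pow-λt-above k m k<m))

      pow-λt-diag : ∀ m → pow λt m m ≈ lam ^ m
      pow-λt-diag zero    = refl
      pow-λt-diag (suc m) = trans (λt·f (pow λt m) m) (*-congˡ (pow-λt-diag m))

      falling-λ⁻¹ : ∀ m → falling (lam ⁻¹) m * lam ^ m ≈ fallingDeg 1# m lam
      falling-λ⁻¹ zero    = *-identityˡ 1#
      falling-λ⁻¹ (suc m) = begin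
        falling (lam ⁻¹) m * (lam ⁻¹ - fromℕ m * 1#) * (lam * lam ^ m)
          ≈⟨ solve 5 (λ F a n l P → F :* (a :- n :* con (+ 1)) :* (l :* P) := F :* P :* (a :* l :- n :* l)) refl
                     (falling (lam ⁻¹) m) (lam ⁻¹) (fromℕ m) lam (lam ^ m) ⟩
        falling (lam ⁻¹) m * lam ^ m * (lam ⁻¹ * lam - fromℕ m * lam)
          ≈⟨ *-cong (falling-λ⁻¹ m) (+-congʳ (x⁻¹*x≈1 lam≉0)) ⟩
        fallingDeg 1# m lam * (1# - fromℕ m * lam) ∎

    -- Only the k = m term of the binomial series (1 + λt)^{1/λ} reaches tᵐ.
    eDeg-coeff : ∀ m → eDeg lam m ≈ degBinom m 1#
    eDeg-coeff m = begin
      eDeg lam m                                         ≈⟨ diagonal m ⟩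
      binom (lam ⁻¹) m * lam ^ m
        ≈⟨ solve 3 (λ a b c → a :* b :* c := a :* c :* b) refl (falling (lam ⁻¹) m) (fromℕ (m !) ⁻¹) (lam ^ m) ⟩
      falling (lam ⁻¹) m * lam ^ m * fromℕ (m !) ⁻¹      ≈⟨ *-congʳ (falling-λ⁻¹ m) ⟩
      degBinom m 1#                                      ∎
      where
      diagonal : ∀ m → eDeg lam m ≈ binom (lam ⁻¹) m * lam ^ m
      diagonal zero    = refl
      diagonal (suc m) = trans
        (+-cong (sumTo-zero m (λ k k≤m → y≈0⇒x*y≈0 (pow-λt-above k (suc m) (s≤s k≤m))))
                (*-congˡ (pow-λt-diag (suc m))))
        (+-identityˡ _)

    pow-eDeg : ∀ r N → pow (eDeg lam) r N ≈ degBinom N (fromℕ r)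
    pow-eDeg zero    zero    = sym (degBinom-zero 0#)
    pow-eDeg zero    (suc N) = sym (x≈0⇒x*y≈0 (fallingDeg-zero lam N))
    pow-eDeg (suc r) N = begin
      sumTo N (λ i → eDeg lam i * pow (eDeg lam) r (N ∸ i))
        ≈⟨ sumTo-cong N (λ i _ → *-cong (eDeg-coeff i) (pow-eDeg r (N ∸ i))) ⟩
      sumTo N (λ i → degBinom i 1# * degBinom (N ∸ i) (fromℕ r))
        ≈⟨ degBinom-vandermonde N 1# (fromℕ r) ⟨
      degBinom N (fromℕ (suc r)) ∎

    eDeg-zero : eDeg lam 0 ≈ 1#
    eDeg-zero = trans (eDeg-coeff 0) (degBinom-zero 1#)

    eDegShift-zero : eDegShift lam 0 ≈ 1#
    eDegShift-zero = trans (eDeg-coeff 1) (trans (*-cong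
      (solve 1 (λ l → con (+ 1) :* (con (+ 1) :- con (+ 0) :* l) := con (+ 1)) refl lam) (⁻¹-cong fromℕ-1))
      (trans (*-identityˡ _) 1⁻¹≈1))

    pow-eDeg-minusOne : ∀ i n → pow (minusOne (eDeg lam)) i (n ℕ.+ i) ≈ pow (eDegShift lam) i n
    pow-eDeg-minusOne zero    n = trans (reflexive (≡.cong (pow (minusOne (eDeg lam)) 0) (ℕₚ.+-identityʳ n)))
                                        (trans (pow-zero (minusOne (eDeg lam)) n) (sym (pow-zero (eDegShift lam) n)))
    pow-eDeg-minusOne (suc i) n = begin
      pow E (suc i) (n ℕ.+ suc i)
        ≈⟨ reflexive (≡.cong (pow E (suc i)) (ℕₚ.+-suc n i)) ⟩
      sumTo (suc (n ℕ.+ i)) (λ k → E k * pow E i (suc (n ℕ.+ i) ∸ k))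
        ≈⟨ sumTo-suc-head (n ℕ.+ i) _ ⟩
      E 0 * pow E i (suc (n ℕ.+ i)) + sumTo (n ℕ.+ i) (λ k → g k * pow E i (n ℕ.+ i ∸ k))
        ≈⟨ +-cong (x≈0⇒x*y≈0 E0≈0) (sumTo-extend (ℕₚ.m≤m+n n i) high≈0) ⟩
      0# + sumTo n (λ k → g k * pow E i (n ℕ.+ i ∸ k))
        ≈⟨ +-identityˡ _ ⟩
      sumTo n (λ k → g k * pow E i (n ℕ.+ i ∸ k))
        ≈⟨ sumTo-cong n (λ k k≤n → *-congˡ (trans
             (reflexive (≡.cong (pow E i) (ℕₚ.+-∸-comm i k≤n))) (pow-eDeg-minusOne i (n ∸ k)))) ⟩
      pow g (suc i) n ∎
      where
      E g : Series
      E = minusOne (eDeg lam)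
      g = eDegShift lam
      E0≈0 : E 0 ≈ 0#
      E0≈0 = minusOne-zero (eDeg lam) eDeg-zero
      high≈0 : ∀ k → n < k → k ≤ n ℕ.+ i → g k * pow E i (n ℕ.+ i ∸ k) ≈ 0#
      high≈0 k n<k k≤n+i = y≈0⇒x*y≈0 (pow-below E0≈0 i _ n+i∸k<i)
        where
        n+i∸k<i : n ℕ.+ i ∸ k < i
        n+i∸k<i = ≡.subst (λ z → n ℕ.+ i ∸ k < z) (ℕₚ.m+n∸m≡n n i) (ℕₚ.∸-monoʳ-< n<k k≤n+i)

    module _ (S : ℕ → ℕ → Carrier) (stirling : IsDegStirling2 lam S) where

      pow-eDeg-minusOne-stirling : ∀ N i → i ≤ N → fromℕ (N !) * pow (minusOne (eDeg lam)) i N ≈ fromℕ (i !) * S N i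
      pow-eDeg-minusOne-stirling N =
        binomialTransform-injective N (λ k → fromℕ (N !) * pow E k N) (λ k → fromℕ (k !) * S N k) transforms
        where
        E : Series
        E = minusOne (eDeg lam)
        transforms : ∀ r → r ≤ N →
          sumTo r (λ k → binomℕ r k * (fromℕ (N !) * pow E k N)) ≈ sumTo r (λ k → binomℕ r k * (fromℕ (k !) * S N k))
        transforms r r≤N = begin
          sumTo r (λ k → binomℕ r k * (fromℕ (N !) * pow E k N))
            ≈⟨ sumTo-extend r≤N (λ k r<k _ → x≈0⇒x*y≈0 (binomℕ-above r<k)) ⟨
          sumTo N (λ k → binomℕ r k * (fromℕ (N !) * pow E k N))
            ≈⟨ sumTo-cong N (λ k _ → solve 3 (λ a b c → a :* (b :* c) := b :* (a :* c)) refl (binomℕ r k) (fromℕ (N !)) (pow E k N)) ⟩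
          sumTo N (λ k → fromℕ (N !) * (binomℕ r k * pow E k N))
            ≈⟨ sumTo-*ˡ N _ _ ⟨
          fromℕ (N !) * (binomℕ r ∘ₛ E) N
            ≈⟨ *-congˡ (pow-binomial (eDeg lam) eDeg-zero r N) ⟨
          fromℕ (N !) * pow (eDeg lam) r N
            ≈⟨ *-congˡ (pow-eDeg r N) ⟩
          fromℕ (N !) * (fallingDeg (fromℕ r) N lam * fromℕ (N !) ⁻¹)
            ≈⟨ solve 3 (λ a b c → a :* (b :* c) := b :* (a :* c)) refl (fromℕ (N !)) _ _ ⟩
          fallingDeg (fromℕ r) N lam * (fromℕ (N !) * fromℕ (N !) ⁻¹)
            ≈⟨ trans (*-congˡ (x*x⁻¹≈1 (fromℕ-n!≉0 N))) (*-identityʳ _) ⟩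
          fallingDeg (fromℕ r) N lam
            ≈⟨ stirling N (fromℕ r) ⟩
          sumTo N (λ k → S N k * falling (fromℕ r) k)
            ≈⟨ sumTo-cong N (λ k _ → trans (*-congˡ (falling-fromℕ r k))
                 (solve 3 (λ s f c → s :* (f :* c) := c :* (f :* s)) refl (S N k) (fromℕ (k !)) (binomℕ r k))) ⟩
          sumTo N (λ k → binomℕ r k * (fromℕ (k !) * S N k))
            ≈⟨ sumTo-extend r≤N (λ k r<k _ → x≈0⇒x*y≈0 (binomℕ-above r<k)) ⟩
          sumTo r (λ k → binomℕ r k * (fromℕ (k !) * S N k)) ∎

      pow-eDegShift-stirling : ∀ n i → binomℕ (n ℕ.+ i) n * (fromℕ (n !) * pow (eDegShift lam) i n) ≈ S (n ℕ.+ i) i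
      pow-eDegShift-stirling n i = *-cancelˡ (fromℕ-n!≉0 i) (begin
        fromℕ (i !) * (binomℕ (n ℕ.+ i) n * (fromℕ (n !) * pow g i n))
          ≈⟨ solve 4 (λ a b c d → a :* (b :* (c :* d)) := b :* (a :* c) :* d) refl (fromℕ (i !)) _ (fromℕ (n !)) _ ⟩
        binomℕ (n ℕ.+ i) n * (fromℕ (i !) * fromℕ (n !)) * pow g i n
          ≈⟨ *-congʳ (*-cong (reflexive (≡.cong fromℕ ([n+j]Cn≡[n+j]Cj n i))) (sym (fromℕ-* (i !) (n !)))) ⟩
        binomℕ (n ℕ.+ i) i * fromℕ (i ! ℕ.* n !) * pow g i n
          ≈⟨ *-congʳ (fromℕ-* ((n ℕ.+ i) C i) (i ! ℕ.* n !)) ⟨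
        fromℕ (((n ℕ.+ i) C i) ℕ.* (i ! ℕ.* n !)) * pow g i n
          ≈⟨ *-cong (reflexive (≡.cong fromℕ ([n+i]Ci*[i!*n!]≡[n+i]! n i))) (sym (pow-eDeg-minusOne i n)) ⟩
        fromℕ ((n ℕ.+ i) !) * pow (minusOne (eDeg lam)) i (n ℕ.+ i)
          ≈⟨ pow-eDeg-minusOne-stirling (n ℕ.+ i) i (ℕₚ.m≤n+m i n) ⟩
        fromℕ (i !) * S (n ℕ.+ i) i ∎)
        where
        g : Series
        g = eDegShift lam

  binomℕ-+≉0 : ∀ n i → ¬ (binomℕ (n ℕ.+ i) n ≈ 0#)
  binomℕ-+≉0 n i C≈0 = fromℕ-n!≉0 (n ℕ.+ i) (begin
    fromℕ ((n ℕ.+ i) !)                              ≈⟨ reflexive (≡.cong fromℕ (≡.sym ([n+i]Ci*[i!*n!]≡[n+i]! n i))) ⟩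
    fromℕ (((n ℕ.+ i) C i) ℕ.* (i ! ℕ.* n !))        ≈⟨ fromℕ-* ((n ℕ.+ i) C i) (i ! ℕ.* n !) ⟩
    binomℕ (n ℕ.+ i) i * fromℕ (i ! ℕ.* n !)         ≈⟨ *-congʳ (reflexive (≡.cong fromℕ ([n+j]Cn≡[n+j]Cj n i))) ⟨
    binomℕ (n ℕ.+ i) n * fromℕ (i ! ℕ.* n !)         ≈⟨ x≈0⇒x*y≈0 C≈0 ⟩
    0#                                               ∎)

  betaDeg-summand : ∀ lam α n i (S : ℕ → ℕ → Carrier) → ¬ (lam ≈ 0#) → ¬ (α + fromℕ i ≈ 0#) →
    IsDegStirling2 lam S →
    fromℕ (n !) * (powersCoeff (- α) n i * pow (eDegShift lam) i n) ≈
      α * binom (α + fromℕ n) n * (sign i * binomℕ n i * ((α + fromℕ i) * binomℕ (n ℕ.+ i) n) ⁻¹ * S (n ℕ.+ i) i)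
  betaDeg-summand lam α n i S lam≉0 a≉0 stirling = begin
    fromℕ (n !) * (powersCoeff (- α) n i * pow (eDegShift lam) i n)
      ≈⟨ solve 3 (λ f k p → f :* (k :* p) := k :* (f :* p)) refl (fromℕ (n !)) (powersCoeff (- α) n i) _ ⟩
    powersCoeff (- α) n i * (fromℕ (n !) * pow (eDegShift lam) i n)
      ≈⟨ *-cong (a*x≈y⇒x≈a⁻¹*y a≉0 (powersCoeff-neg α n i))
                (a*x≈y⇒x≈a⁻¹*y (binomℕ-+≉0 n i) (pow-eDegShift-stirling S stirling n i)) ⟩
    a ⁻¹ * (sign i * (α * B * binomℕ n i)) * (C ⁻¹ * S (n ℕ.+ i) i)
      ≈⟨ solve 7 (λ a′ s α B c C′ T → a′ :* (s :* (α :* B :* c)) :* (C′ :* T) := α :* B :* (s :* c :* (a′ :* C′) :* T))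
                 refl (a ⁻¹) (sign i) α B (binomℕ n i) (C ⁻¹) (S (n ℕ.+ i) i) ⟩
    α * B * (sign i * binomℕ n i * (a ⁻¹ * C ⁻¹) * S (n ℕ.+ i) i)
      ≈⟨ *-congˡ (*-congʳ (*-congˡ (⁻¹-distrib-* a≉0 (binomℕ-+≉0 n i)))) ⟨
    α * B * (sign i * binomℕ n i * (a * C) ⁻¹ * S (n ℕ.+ i) i) ∎
    where
    open DegenerateExponential lam lam≉0
    a B C : Carrier
    a = α + fromℕ i
    B = binom (α + fromℕ n) n
    C = binomℕ (n ℕ.+ i) n

theorem2p19 : ∀ {c ℓ : Level} (F : CharZeroField c ℓ) →
    let open CharZeroField F
        open Degenerate F
    in ∀ (lam α : Carrier) (n : ℕ) (S : ℕ → ℕ → Carrier) →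
       ¬ (lam ≈ 0#) →
       (∀ j → j ≤ n → ¬ (α + fromℕ j ≈ 0#)) →
       IsDegStirling2 lam S →
       betaDeg n lam α ≈
         α * binom (α + fromℕ n) n *
           sumTo n (λ j → sign j * fromℕ (n C j)
                            * (((α + fromℕ j) * fromℕ ((n Data.Nat.+ j) C n)) ⁻¹)
                            * S (n Data.Nat.+ j) j)
theorem2p19 F lam α n S lam≉0 α+j≉0 stirling = begin
  fromℕ (n !) * powSeries (invSeries g) α n
    ≈⟨ *-congˡ (powSeries-invSeries g eDegShift-zero α n) ⟩
  fromℕ (n !) * powSeries g (- α) n
    ≈⟨ *-congˡ (powSeries-powers g (- α) n) ⟩
  fromℕ (n !) * sumTo n (λ i → powersCoeff (- α) n i * pow g i n)
    ≈⟨ sumTo-*ˡ n _ _ ⟩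
  sumTo n (λ i → fromℕ (n !) * (powersCoeff (- α) n i * pow g i n))
    ≈⟨ sumTo-cong n (λ i i≤n → betaDeg-summand lam α n i S lam≉0 (α+j≉0 i i≤n) stirling) ⟩
  sumTo n (λ i → α * B * summand i)
    ≈⟨ sumTo-*ˡ n _ _ ⟨
  α * B * sumTo n summand ∎
  where
  open CharZeroField F hiding (zero)
  open Degenerate F
  open DegenerateProperties F
  open DegenerateExponential lam lam≉0
  open import Relation.Binary.Reasoning.Setoid setoid
  g : Series
  g = eDegShift lam
  B : Carrier
  B = binom (α + fromℕ n) n
  summand : ℕ → Carrier
  summand i = sign i * binomℕ n i * ((α + fromℕ i) * binomℕ (n ℕ.+ i) n) ⁻¹ * S (n ℕ.+ i) i
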